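{- Let $p$ be an odd prime, $n$ a positive integer with $\gcd(p,n)=1$, $q=p^n$, so that $x^p-x-1$ is irreducible in $\mathbb{F}_q[x]$; let $K=\mathbb{F}_q[x]/(x^p-x-1)$, let $\theta$ be the coset of $x$ in $K$, and let $b\in\mathbb{F}_q$ with $b\notin\mathbb{F}_{p^m}$ for every proper divisor $m$ of $n$. Let $s,t$ be nonnegative integers with $s+t\le p-1$, and let $I_{s,t}$ be the set of vectors $\vec r=(r_0,r_1,\dots,r_{np-1})\in\mathbb{Z}^{np}$ such that $$\sum_{0\le j\le np-1,\ r_j<0}(-r_j)\le t\quad\text{and}\quad\sum_{0\le j\le np-1,\ r_j>0}r_j\le s.$$ Let $G=\langle\theta+b\rangle\le K^*$. Then the map $\Lambda:I_{s,t}\to G$ defined by $\Lambda(\vec r)=\prod_{0\le j\le np-1}(\theta+b)^{r_jp^j}$ is injective.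
   Context: For $m\mid n$, $\mathbb{F}_{p^m}$ is the subfield of $\mathbb{F}_q$ of order $p^m$. $\langle\theta+b\rangle$ is the cyclic subgroup of $K^*$ generated by $\theta+b$. -}

module Defs where

open import Level using (0ℓ)
open import Data.Nat as ℕ using (ℕ; zero; suc)
open import Data.Integer as ℤ using (ℤ; +_; -[1+_])
open import Data.Fin using (Fin)
import Data.Fin
open import Data.Bool using (Bool; true; false; if_then_else_)
open import Data.Product using (Σ; _×_; _,_)
open import Relation.Binary.PropositionalEquality using (_≡_)
open import Relation.Nullary using (¬_)
open import Algebra.Structures using (IsCommutativeRing)
open import Function.Bundles using (_↔_)
open import Function.Bundles using (module Inverse)

sumFin : (n : ℕ) → (Fin n → ℕ) → ℕ
sumFin zero    f = 0
sumFin (suc n) f = f Fin.zero ℕ.+ sumFin n (λ i → f (Fin.suc i))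
  where import Data.Fin as Fin

-- Fields (with propositional equality).  The inverse is a total
-- operation, only constrained on nonzero elements.

record Field : Set₁ where
  infixl 6 _+_
  infixl 7 _*_
  field
    Carrier : Set
    _+_ _*_ : Carrier → Carrier → Carrier
    -_      : Carrier → Carrier
    0# 1#   : Carrier
    _⁻¹     : Carrier → Carrier
    isCommutativeRing : IsCommutativeRing _≡_ _+_ _*_ -_ 0# 1#
    0≢1     : ¬ (0# ≡ 1#)
    inverseʳ : ∀ x → ¬ (x ≡ 0#) → x * (x ⁻¹) ≡ 1#

  _^_ : Carrier → ℕ → Carrier
  x ^ zero  = 1#
  x ^ suc k = x * (x ^ k)

  _^ℤ_ : Carrier → ℤ → Carrier
  x ^ℤ (+ k)     = x ^ k
  x ^ℤ -[1+ k ]  = (x ⁻¹) ^ suc k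

  prodFin : (n : ℕ) → (Fin n → Carrier) → Carrier
  prodFin zero    f = 1#
  prodFin (suc n) f = f Fin.zero * prodFin n (λ i → f (Fin.suc i))
    where import Data.Fin as Fin

  sumK : (n : ℕ) → (Fin n → Carrier) → Carrier
  sumK zero    f = 0#
  sumK (suc n) f = f Fin.zero + sumK n (λ i → f (Fin.suc i))
    where import Data.Fin as Fin

record FiniteField (q : ℕ) : Set₁ where
  field
    field′ : Field
  open Field field′ public
  field
    enum : Fin q ↔ Carrier
  open Inverse enum public using (to)

  count : (Carrier → Bool) → ℕ
  count P = sumFin q (λ i → if P (to i) then 1 else 0)

  record Subfield : Set where
    field
      mem    : Carrier → Bool
      has0   : mem 0# ≡ true
      has1   : mem 1# ≡ true
      closed+ : ∀ x y → mem x ≡ true → mem y ≡ true → mem (x + y) ≡ true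
      closed* : ∀ x y → mem x ≡ true → mem y ≡ true → mem (x * y) ≡ true
      closed- : ∀ x → mem x ≡ true → mem (- x) ≡ true
      closed⁻¹ : ∀ x → mem x ≡ true → ¬ (x ≡ 0#) → mem (x ⁻¹) ≡ true

  NotInSubfieldOfOrder : ℕ → Carrier → Set
  NotInSubfieldOfOrder r x =
    (S : Subfield) → count (Subfield.mem S) ≡ r → ¬ (Subfield.mem S x ≡ true)

-- K = F[x]/(x^p - x - 1): a field K together with a ring embedding
-- ι : F → K and an element θ (the coset of x) with θ^p = θ + 1 such that
-- every element of K is uniquely  Σ_{i<p} ι(a_i) θ^i.

record ArtinSchreierExt {q : ℕ} (F : FiniteField q) (p : ℕ) : Set₁ where
  private module F = FiniteField F
  field
    K : Field
  open Field K public
  field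
    ι     : F.Carrier → Carrier
    ι-+   : ∀ a b → ι (a F.+ b) ≡ ι a + ι b
    ι-*   : ∀ a b → ι (a F.* b) ≡ ι a * ι b
    ι-1   : ι F.1# ≡ 1#
    θ     : Carrier
    θ-root : θ ^ p ≡ θ + 1#
    spans  : ∀ z → Σ (Fin p → F.Carrier) (λ a → z ≡ sumK p (λ i → ι (a i) * (θ ^ Data.Fin.toℕ i)))
    unique : ∀ (a a′ : Fin p → F.Carrier) →
             sumK p (λ i → ι (a i) * (θ ^ Data.Fin.toℕ i)) ≡ sumK p (λ i → ι (a′ i) * (θ ^ Data.Fin.toℕ i)) →
             ∀ i → a i ≡ a′ i

posPart : ℤ → ℕ
posPart (+ k)    = k
posPart -[1+ k ] = 0

negPart : ℤ → ℕ
negPart (+ k)    = 0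
negPart -[1+ k ] = suc k

InI : (N s t : ℕ) → (Fin N → ℤ) → Set
InI N s t r = (sumFin N (λ j → negPart (r j)) ℕ.≤ t) × (sumFin N (λ j → posPart (r j)) ℕ.≤ s)

module Submission where

-- Put c j = j + b ^ (p ^ j) ∈ F.  As θ ^ p = θ + 1, the Frobenius map gives
-- (θ + b) ^ (p ^ j) = θ + c j, so Λ r = ∏ (θ + c j) ^ r j.  Multiplying out the
-- denominators, Λ r = Λ r′ becomes ∏ (θ + c j) ^ a j = ∏ (θ + c j) ^ a′ j with
-- a j = r j⁺ + r′ j⁻ and a′ j = r′ j⁺ + r j⁻, both of total degree ≤ s + t < p.
-- Both sides are values at θ of polynomials over F of degree < p, and 1, θ, …, θ ^ (p - 1)
-- are independent over F, so ∏ (x + c j) ^ a j = ∏ (x + c j) ^ a′ j in F[x]; since the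
-- c j are pairwise distinct, unique factorisation (done by hand: evaluate at - c j and
-- cancel) gives a = a′, hence r = r′.
--
-- The c j are distinct: c j = c (j + d) with 0 < d < n p forces p ∣ d (as gcd p n = 1), so
-- b is fixed by x ↦ x ^ (p ^ g) for g = gcd d n < n.  The fixed points of that map form a
-- subfield with exactly p ^ g elements: at most by the root bound for x ^ (p ^ g) - x,
-- at least because x ↦ x ^ (p ^ g) - x is additive with that kernel and its image lies in
-- the roots of the trace polynomial of degree p ^ (n - g).  This contradicts the hypothesis on b.

open import Level using (0ℓ)
open import Defs
open import Data.Nat as ℕ using (ℕ; zero; suc; s≤s; z≤n)
import Data.Nat.Properties as ℕ
open import Data.Nat.Divisibility using (_∣_; divides; m%n≡0⇒n∣m)
open import Data.Nat.DivMod using (_/_; _%_; m/n*n≡m; m≡m%n+[m/n]*n; m%n<n)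
open import Data.Nat.Primality using (Prime; euclidsLemma; prime⇒nonZero)
open import Data.Nat.Combinatorics using (_C_; nCn≡1; nCk≡n!/k![n-k]!; k![n∸k]!∣n!)
open import Data.Nat.Coprimality using (coprime-Bézout; prime⇒coprime; coprime-divisor; gcd≡1⇒coprime)
open import Data.Nat.GCD using (gcd; gcd-GCD; module Bézout; gcd[m,n]≤n; gcd[m,n]∣m; gcd[m,n]∣n; gcd[m,n]≢0)
open import Data.Fin using (Fin; toℕ; zero; suc)
import Data.Fin as Fin
import Data.Fin.Properties as Fin
open import Data.Fin.Properties using (any?)
open import Data.Fin.Permutation using (Permutation; _⟨$⟩ʳ_)
open import Data.Vec.Functional using (updateAt)
open import Data.Vec.Functional.Properties using (updateAt-updates; updateAt-minimal)
open import Data.List using (List; []; _∷_; length)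
open import Data.Bool using (Bool; true; false; if_then_else_; _∨_)
open import Data.Product using (_,_; ∃)
open import Data.Sum using (inj₁; inj₂)
open import Data.Empty using (⊥-elim)
open import Data.Maybe using (nothing)
open import Function using (_∘_)
open import Function.Bundles using (_↔_; Inverse; mk↔ₛ′)
open import Function.Properties.Inverse using (↔-trans; ↔-sym)
open import Relation.Nullary using (¬_; Dec; yes; no; does)
open import Relation.Nullary.Decidable using (dec-true; dec-false)
open import Relation.Binary.Definitions using (DecidableEquality; tri<; tri≈; tri>)
open import Relation.Binary.PropositionalEquality using (_≡_; refl; sym; trans; cong; cong₂; subst; module ≡-Reasoning)
open import Algebra.Bundles using (CommutativeRing; CommutativeMonoid; Semiring)
import Algebra.Properties.CommutativeMonoid.Sum as CommutativeMonoidSum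
import Algebra.Properties.Ring as RingProperties
import Algebra.Properties.CommutativeSemiring.Binomial as Binomial
import Algebra.Definitions.RawSemiring as RawSemiringDefinitions
import Algebra.Properties.Semiring.Sum as SemiringSum
import Algebra.Properties.Semiring.Exp as SemiringExp
import Algebra.Properties.Semiring.Mult as SemiringMult
import Tactic.RingSolver.Core.AlmostCommutativeRing as ACR
import Tactic.RingSolver.NonReflective as RingSolver

-- The finite sums and products of Defs (sumFin, sumK, prodFin) all satisfy these two
-- equations, which lets them inherit the library's lemmas about sum.
module FoldProperties (M : CommutativeMonoid 0ℓ 0ℓ)
  (fold : ∀ n → (Fin n → CommutativeMonoid.Carrier M) → CommutativeMonoid.Carrier M)
  (fold-zero : ∀ f → fold 0 f ≡ CommutativeMonoid.ε M)
  (fold-suc : ∀ n f → fold (suc n) f ≡ CommutativeMonoid._∙_ M (f zero) (fold n (f ∘ suc))) where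
  open CommutativeMonoid M using (_≈_; _∙_; ε; setoid) renaming (Carrier to A)
  open CommutativeMonoidSum M using (sum; sum-cong-≗; ∑-permute; ∑-comm; ∑-distrib-+)
  open import Relation.Binary.Reasoning.Setoid setoid

  fold≡sum : ∀ n f → fold n f ≡ sum f
  fold≡sum zero    f = fold-zero f
  fold≡sum (suc n) f = trans (fold-suc n f) (cong (f zero ∙_) (fold≡sum n (f ∘ suc)))

  fold-permute : ∀ {n} (f : Fin n → A) (π : Permutation n n) → fold n f ≈ fold n (f ∘ (π ⟨$⟩ʳ_))
  fold-permute {n} f π = begin
    fold n f                 ≡⟨ fold≡sum n f ⟩
    sum f                    ≈⟨ ∑-permute f π ⟩
    sum (f ∘ (π ⟨$⟩ʳ_))      ≡⟨ fold≡sum n _ ⟨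
    fold n (f ∘ (π ⟨$⟩ʳ_))   ∎

  fold-cong : ∀ n {f g : Fin n → A} → (∀ i → f i ≡ g i) → fold n f ≡ fold n g
  fold-cong n {f} {g} f≗g = trans (fold≡sum n f) (trans (sum-cong-≗ f≗g) (sym (fold≡sum n g)))

  fold-bijection : ∀ {q} {X : Set} (enum : Fin q ↔ X) (σ : X ↔ X) (f : X → A) →
                   fold q (f ∘ Inverse.to enum) ≈ fold q (f ∘ Inverse.to σ ∘ Inverse.to enum)
  fold-bijection {q} enum σ f = begin
    fold q (f ∘ Inverse.to enum)                    ≈⟨ fold-permute (f ∘ Inverse.to enum) π ⟩
    fold q (f ∘ Inverse.to enum ∘ (π ⟨$⟩ʳ_))        ≡⟨ fold-cong q (λ i → cong f (Inverse.strictlyInverseˡ enum _)) ⟩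
    fold q (f ∘ Inverse.to σ ∘ Inverse.to enum)     ∎
    where
    π : Permutation q q
    π = ↔-trans enum (↔-trans σ (↔-sym enum))

  fold-∙ : ∀ n (f g : Fin n → A) → fold n (λ i → f i ∙ g i) ≈ fold n f ∙ fold n g
  fold-∙ n f g = begin
    fold n (λ i → f i ∙ g i)   ≡⟨ fold≡sum n _ ⟩
    sum (λ i → f i ∙ g i)      ≈⟨ ∑-distrib-+ f g ⟩
    sum f ∙ sum g              ≡⟨ cong₂ _∙_ (fold≡sum n f) (fold≡sum n g) ⟨
    fold n f ∙ fold n g        ∎

  fold-comm : ∀ m n (f : Fin m → Fin n → A) → fold m (λ i → fold n (f i)) ≈ fold n (λ j → fold m (λ i → f i j))
  fold-comm m n f = begin
    fold m (λ i → fold n (f i))              ≡⟨ trans (fold-cong m (λ i → fold≡sum n (f i))) (fold≡sum m _) ⟩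
    sum (λ i → sum (f i))                    ≈⟨ ∑-comm f ⟩
    sum (λ j → sum (λ i → f i j))            ≡⟨ trans (fold-cong n (λ j → fold≡sum m _)) (fold≡sum n _) ⟨
    fold n (λ j → fold m (λ i → f i j))      ∎

module SumFinProperties where
  open FoldProperties ℕ.+-0-commutativeMonoid sumFin (λ _ → refl) (λ _ _ → refl) public
    using () renaming (fold-cong to sumFin-cong; fold-∙ to sumFin-+; fold-comm to sumFin-comm; fold-bijection to sumFin-bijection)

  sumFin-mono : ∀ n {f g : Fin n → ℕ} → (∀ i → f i ℕ.≤ g i) → sumFin n f ℕ.≤ sumFin n g
  sumFin-mono zero    f≤g = z≤n
  sumFin-mono (suc n) f≤g = ℕ.+-mono-≤ (f≤g zero) (sumFin-mono n (f≤g ∘ suc))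

  sumFin-*ʳ : ∀ n (f : Fin n → ℕ) c → sumFin n (λ i → f i ℕ.* c) ≡ sumFin n f ℕ.* c
  sumFin-*ʳ zero    f c = refl
  sumFin-*ʳ (suc n) f c = trans (cong (f zero ℕ.* c ℕ.+_) (sumFin-*ʳ n (f ∘ suc) c))
                                (sym (ℕ.*-distribʳ-+ c (f zero) _))

  sumFin-1 : ∀ n → sumFin n (λ _ → 1) ≡ n
  sumFin-1 zero    = refl
  sumFin-1 (suc n) = cong suc (sumFin-1 n)

  sumFin-zero : ∀ n (f : Fin n → ℕ) → (∀ i → f i ≡ 0) → sumFin n f ≡ 0
  sumFin-zero zero    f e = refl
  sumFin-zero (suc n) f e = cong₂ ℕ._+_ (e zero) (sumFin-zero n (f ∘ suc) (e ∘ suc))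

  sumFin-single : ∀ n (j : Fin n) (f : Fin n → ℕ) → (∀ i → ¬ (i ≡ j) → f i ≡ 0) → sumFin n f ≡ f j
  sumFin-single (suc n) zero    f e =
    trans (cong (f zero ℕ.+_) (sumFin-zero n (f ∘ suc) (λ i → e (suc i) λ ()))) (ℕ.+-identityʳ _)
  sumFin-single (suc n) (suc j) f e =
    cong₂ ℕ._+_ (e zero λ ()) (sumFin-single n j (f ∘ suc) (λ i i≢j → e (suc i) (i≢j ∘ Fin.suc-injective)))

  decrementAt : ∀ {N} → Fin N → (Fin N → ℕ) → Fin N → ℕ
  decrementAt j a = updateAt a j ℕ.pred

  sumFin-decrementAt : ∀ N (j : Fin N) (a : Fin N → ℕ) → 0 ℕ.< a j →
                       sumFin N a ≡ suc (sumFin N (decrementAt j a))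
  sumFin-decrementAt (suc N) zero    a 0<aj with a zero
  ... | suc k = refl
  sumFin-decrementAt (suc N) (suc j) a 0<aj =
    trans (cong (a zero ℕ.+_) (sumFin-decrementAt N j (a ∘ suc) 0<aj)) (ℕ.+-suc _ _)

  decrementAt-injective : ∀ {N} (j : Fin N) (a b : Fin N → ℕ) → 0 ℕ.< a j → 0 ℕ.< b j →
                          (∀ i → decrementAt j a i ≡ decrementAt j b i) → ∀ i → a i ≡ b i
  decrementAt-injective j a b 0<aj 0<bj e i with i Fin.≟ j
  ... | no i≢j = trans (sym (updateAt-minimal i j a i≢j)) (trans (e i) (updateAt-minimal i j b i≢j))
  ... | yes refl = pred-injective 0<aj 0<bj
    (trans (sym (updateAt-updates j a)) (trans (e j) (updateAt-updates j b)))
    where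
    pred-injective : ∀ {x y} → 0 ℕ.< x → 0 ℕ.< y → ℕ.pred x ≡ ℕ.pred y → x ≡ y
    pred-injective {suc _} {suc _} _ _ = cong suc

module FieldProperties (K : Field) where
  open SumFinProperties using (decrementAt)
  open Field K public

  commutativeRing : CommutativeRing 0ℓ 0ℓ
  commutativeRing = record { isCommutativeRing = isCommutativeRing }

  open CommutativeRing commutativeRing public
    using ( +-assoc; +-comm; +-identityˡ; +-identityʳ; -‿inverseˡ; -‿inverseʳ
          ; *-assoc; *-comm; *-identityˡ; *-identityʳ; distribˡ; zeroˡ; zeroʳ
          ; commutativeSemiring; +-commutativeMonoid; *-commutativeMonoid)
  open RingProperties (CommutativeRing.ring commutativeRing) public
    using (+-cancelˡ; +-inverseʳ-unique; x∙y⁻¹≈ε⇒x≈y; xyx⁻¹≈y)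
  open RingSolver (ACR.fromCommutativeRing commutativeRing (λ _ → nothing)) public
    using (solve; _⊜_; _⊕_; _⊗_; ⊝_; Κ)
  open ≡-Reasoning

  open FoldProperties +-commutativeMonoid sumK (λ _ → refl) (λ _ _ → refl) public
    using () renaming (fold-cong to sumK-cong; fold-∙ to sumK-+; fold-bijection to sumK-bijection)
  open FoldProperties *-commutativeMonoid prodFin (λ _ → refl) (λ _ _ → refl) public
    using () renaming (fold-cong to prodFin-cong; fold-∙ to prodFin-*; fold-bijection to prodFin-bijection)

  1≢0 : ¬ (1# ≡ 0#)
  1≢0 e = 0≢1 (sym e)

  inverseˡ : ∀ x → ¬ (x ≡ 0#) → x ⁻¹ * x ≡ 1#
  inverseˡ x x≢0 = trans (*-comm _ _) (inverseʳ x x≢0)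

  *-cancelˡ : ∀ w x y → ¬ (w ≡ 0#) → w * x ≡ w * y → x ≡ y
  *-cancelˡ w x y w≢0 e = begin
    x                ≡⟨ *-identityˡ x ⟨
    1# * x           ≡⟨ cong (_* x) (inverseˡ w w≢0) ⟨
    (w ⁻¹ * w) * x   ≡⟨ *-assoc _ _ _ ⟩
    w ⁻¹ * (w * x)   ≡⟨ cong (w ⁻¹ *_) e ⟩
    w ⁻¹ * (w * y)   ≡⟨ *-assoc _ _ _ ⟨
    (w ⁻¹ * w) * y   ≡⟨ cong (_* y) (inverseˡ w w≢0) ⟩
    1# * y           ≡⟨ *-identityˡ y ⟩
    y                ∎

  x≢0∧y≢0⇒x*y≢0 : ∀ {x y} → ¬ (x ≡ 0#) → ¬ (y ≡ 0#) → ¬ (x * y ≡ 0#)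
  x≢0∧y≢0⇒x*y≢0 {x} {y} x≢0 y≢0 xy≡0 = y≢0 (*-cancelˡ x y 0# x≢0 (trans xy≡0 (sym (zeroʳ x))))

  x-y≡0⇒x≡y : ∀ x y → x + - y ≡ 0# → x ≡ y
  x-y≡0⇒x≡y = x∙y⁻¹≈ε⇒x≈y

  +-cancelʳ-0# : ∀ x y → x + y ≡ x → y ≡ 0#
  +-cancelʳ-0# x y e = +-cancelˡ x y 0# (trans e (sym (+-identityʳ x)))

  ^-+ : ∀ x m n → x ^ (m ℕ.+ n) ≡ x ^ m * x ^ n
  ^-+ x zero    n = sym (*-identityˡ _)
  ^-+ x (suc m) n = trans (cong (x *_) (^-+ x m n)) (sym (*-assoc _ _ _))

  *-^ : ∀ x y n → (x * y) ^ n ≡ x ^ n * y ^ n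
  *-^ x y zero    = sym (*-identityˡ _)
  *-^ x y (suc n) = trans (cong ((x * y) *_) (*-^ x y n))
    (solve 4 (λ a b c d → (a ⊗ b) ⊗ (c ⊗ d) ⊜ (a ⊗ c) ⊗ (b ⊗ d)) refl x y (x ^ n) (y ^ n))

  1^ : ∀ n → 1# ^ n ≡ 1#
  1^ zero    = refl
  1^ (suc n) = trans (*-identityˡ _) (1^ n)

  ^-* : ∀ x m n → x ^ (m ℕ.* n) ≡ (x ^ m) ^ n
  ^-* x zero    n = sym (1^ n)
  ^-* x (suc m) n = begin
    x ^ (n ℕ.+ m ℕ.* n)    ≡⟨ ^-+ x n (m ℕ.* n) ⟩
    x ^ n * x ^ (m ℕ.* n)  ≡⟨ cong (x ^ n *_) (^-* x m n) ⟩
    x ^ n * (x ^ m) ^ n    ≡⟨ *-^ x (x ^ m) n ⟨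
    (x * x ^ m) ^ n        ∎

  0^suc : ∀ n → 0# ^ suc n ≡ 0#
  0^suc n = zeroˡ _

  x^n≢0 : ∀ {x} n → ¬ (x ≡ 0#) → ¬ (x ^ n ≡ 0#)
  x^n≢0 zero    x≢0 = 1≢0
  x^n≢0 (suc n) x≢0 = x≢0∧y≢0⇒x*y≢0 x≢0 (x^n≢0 n x≢0)

  x⁻¹^n*x^n≡1 : ∀ x n → ¬ (x ≡ 0#) → (x ⁻¹) ^ n * x ^ n ≡ 1#
  x⁻¹^n*x^n≡1 x n x≢0 = trans (sym (*-^ (x ⁻¹) x n)) (trans (cong (_^ n) (inverseˡ x x≢0)) (1^ n))

  ⁻¹-unique : ∀ x y → ¬ (x ≡ 0#) → y * x ≡ 1# → y ≡ x ⁻¹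
  ⁻¹-unique x y x≢0 e = *-cancelˡ x y (x ⁻¹) x≢0 (trans (*-comm x y) (trans e (sym (inverseʳ x x≢0))))

  ⁻¹-^ : ∀ x n → ¬ (x ≡ 0#) → (x ⁻¹) ^ n ≡ (x ^ n) ⁻¹
  ⁻¹-^ x n x≢0 = ⁻¹-unique (x ^ n) ((x ⁻¹) ^ n) (x^n≢0 n x≢0) (x⁻¹^n*x^n≡1 x n x≢0)

  open RawSemiringDefinitions (Semiring.rawSemiring (CommutativeRing.semiring commutativeRing)) public
    using (_×_)

  private
    module Σ = SemiringSum (CommutativeRing.semiring commutativeRing)
    module B = Binomial commutativeSemiring
    module E = SemiringExp (CommutativeRing.semiring commutativeRing)
    module M = SemiringMult (CommutativeRing.semiring commutativeRing)

  fromℕ : ℕ → Carrier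
  fromℕ n = n × 1#

  fromℕ-+ : ∀ m n → fromℕ (m ℕ.+ n) ≡ fromℕ m + fromℕ n
  fromℕ-+ = M.×-homo-+ 1#

  fromℕ-* : ∀ m n → fromℕ (m ℕ.* n) ≡ fromℕ m * fromℕ n
  fromℕ-* = M.×1-homo-*

  fromℕ-^ : ∀ m n → fromℕ (m ℕ.^ n) ≡ fromℕ m ^ n
  fromℕ-^ m zero    = +-identityʳ 1#
  fromℕ-^ m (suc n) = trans (fromℕ-* m (m ℕ.^ n)) (cong (fromℕ m *_) (fromℕ-^ m n))

  prodFin≢0 : ∀ n (f : Fin n → Carrier) → (∀ i → ¬ (f i ≡ 0#)) → ¬ (prodFin n f ≡ 0#)
  prodFin≢0 zero    f f≢0 = 1≢0
  prodFin≢0 (suc n) f f≢0 = x≢0∧y≢0⇒x*y≢0 (f≢0 zero) (prodFin≢0 n (f ∘ suc) (f≢0 ∘ suc))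

  prodFin-zero : ∀ n (f : Fin n → Carrier) (j : Fin n) → f j ≡ 0# → prodFin n f ≡ 0#
  prodFin-zero (suc n) f zero    e = trans (cong (_* prodFin n (f ∘ suc)) e) (zeroˡ _)
  prodFin-zero (suc n) f (suc j) e = trans (cong (f zero *_) (prodFin-zero n (f ∘ suc) j e)) (zeroʳ _)

  prodFin-^-decrementAt : ∀ N (j : Fin N) (w : Fin N → Carrier) (a : Fin N → ℕ) → 0 ℕ.< a j →
                          prodFin N (λ i → w i ^ a i) ≡ w j * prodFin N (λ i → w i ^ decrementAt j a i)
  prodFin-^-decrementAt (suc N) zero    w a 0<aj with a zero
  ... | suc k = *-assoc _ _ _
  prodFin-^-decrementAt (suc N) (suc j) w a 0<aj =
    trans (cong (w zero ^ a zero *_) (prodFin-^-decrementAt N j (w ∘ suc) (a ∘ suc) 0<aj))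
          (solve 3 (λ x y z → (x ⊗ (y ⊗ z)) ⊜ (y ⊗ (x ⊗ z))) refl _ _ _)

  prodFin-const : ∀ n b → prodFin n (λ _ → b) ≡ b ^ n
  prodFin-const zero    b = refl
  prodFin-const (suc n) b = cong (b *_) (prodFin-const n b)

  prodFin-ones : ∀ n (f : Fin n → Carrier) → (∀ i → f i ≡ 1#) → prodFin n f ≡ 1#
  prodFin-ones zero    f e = refl
  prodFin-ones (suc n) f e = trans (cong₂ _*_ (e zero) (prodFin-ones n (f ∘ suc) (e ∘ suc))) (*-identityˡ 1#)

  prodFin-single : ∀ n (j : Fin n) (f : Fin n → Carrier) → (∀ i → ¬ (i ≡ j) → f i ≡ 1#) → prodFin n f ≡ f j
  prodFin-single (suc n) zero    f e =
    trans (cong (f zero *_) (prodFin-ones n (f ∘ suc) (λ i → e (suc i) λ ()))) (*-identityʳ _)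
  prodFin-single (suc n) (suc j) f e =
    trans (cong₂ _*_ (e zero λ ()) (prodFin-single n j (f ∘ suc) (λ i i≢j → e (suc i) (i≢j ∘ Fin.suc-injective))))
          (*-identityˡ _)

  sumK-zero : ∀ n (f : Fin n → Carrier) → (∀ i → f i ≡ 0#) → sumK n f ≡ 0#
  sumK-zero zero    f e = refl
  sumK-zero (suc n) f e = trans (cong₂ _+_ (e zero) (sumK-zero n (f ∘ suc) (e ∘ suc))) (+-identityʳ 0#)

  sumK-*ˡ : ∀ n x (f : Fin n → Carrier) → x * sumK n f ≡ sumK n (λ i → x * f i)
  sumK-*ˡ zero    x f = zeroʳ x
  sumK-*ˡ (suc n) x f = trans (distribˡ x _ _) (cong ((x * f zero) +_) (sumK-*ˡ n x (f ∘ suc)))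

  sumK-1 : ∀ n → sumK n (λ _ → 1#) ≡ fromℕ n
  sumK-1 zero    = refl
  sumK-1 (suc n) = cong (1# +_) (sumK-1 n)

  ^≡^ : ∀ x n → x ^ n ≡ x E.^ n
  ^≡^ x zero    = refl
  ^≡^ x (suc n) = cong (x *_) (^≡^ x n)

  ×≡fromℕ* : ∀ m x → m × x ≡ fromℕ m * x
  ×≡fromℕ* m x = trans (cong (m ×_) (sym (*-identityˡ x))) (sym (M.×-assoc-* m 1# x))

  -- Only the two outer terms of the binomial expansion survive.
  +-^-additive : ∀ m → (∀ k → 0 ℕ.< k → k ℕ.< suc m → fromℕ (suc m C k) ≡ 0#) →
                 ∀ x y → (x + y) ^ suc m ≡ x ^ suc m + y ^ suc m
  +-^-additive m middle x y = begin
    (x + y) ^ suc m                                       ≡⟨ ^≡^ (x + y) (suc m) ⟩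
    (x + y) E.^ suc m                                     ≡⟨ B.theorem (suc m) x y ⟩
    t zero + Σ.sum (t ∘ suc)                              ≡⟨ cong (t zero +_) (Σ.sum-init-last (t ∘ suc)) ⟩
    t zero + (Σ.sum (t ∘ suc ∘ Fin.inject₁) + t topIndex) ≡⟨ cong₂ (λ a b → t zero + (a + b)) middle≡0 top≡x^ ⟩
    t zero + (0# + x E.^ suc m)                           ≡⟨ trans (cong (t zero +_) (+-identityˡ _)) (+-comm _ _) ⟩
    x E.^ suc m + t zero                                  ≡⟨ cong₂ _+_ (^≡^ x (suc m)) (trans (^≡^ y (suc m)) (sym bottom≡y^)) ⟨
    x ^ suc m + y ^ suc m                                 ∎
    where
    t = B.binomialTerm x y (suc m)
    topIndex = suc (Fin.fromℕ m)
    bottom≡y^ : t zero ≡ y E.^ suc m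
    bottom≡y^ = trans (+-identityʳ _) (*-identityˡ _)
    top≡x^ : t topIndex ≡ x E.^ suc m
    top≡x^ = begin
      (suc m C toℕ topIndex) × (x E.^ toℕ topIndex * y E.^ (suc m ℕ.∸ toℕ topIndex))
        ≡⟨ cong (λ k → (suc m C k) × (x E.^ k * y E.^ (suc m ℕ.∸ k))) (cong suc (Fin.toℕ-fromℕ m)) ⟩
      (suc m C suc m) × (x E.^ suc m * y E.^ (m ℕ.∸ m))
        ≡⟨ cong₂ (λ c k → c × (x E.^ suc m * y E.^ k)) (nCn≡1 (suc m)) (ℕ.n∸n≡0 m) ⟩
      x E.^ suc m * 1# + 0#  ≡⟨ trans (+-identityʳ _) (*-identityʳ _) ⟩
      x E.^ suc m            ∎
    middle≡0 : Σ.sum (t ∘ suc ∘ Fin.inject₁) ≡ 0#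
    middle≡0 = trans (Σ.sum-cong-≗ term≡0) (Σ.sum-replicate-zero m)
      where
      term≡0 : ∀ i → t (suc (Fin.inject₁ i)) ≡ 0#
      term≡0 i = begin
        t (suc (Fin.inject₁ i))    ≡⟨ ×≡fromℕ* (suc m C toℕ (suc (Fin.inject₁ i))) b ⟩
        fromℕ (suc m C toℕ (suc (Fin.inject₁ i))) * b ≡⟨ cong (_* b) (middle _ (s≤s z≤n) (s≤s k<m)) ⟩
        0# * b                     ≡⟨ zeroˡ b ⟩
        0#                         ∎
        where
        b = B.binomial x y (suc m) (suc (Fin.inject₁ i))
        k<m : toℕ (Fin.inject₁ i) ℕ.< m
        k<m = subst (ℕ._< m) (sym (Fin.toℕ-inject₁ i)) (Fin.toℕ<n i)

module PrimeNat where
  open import Data.Nat using (_*_; _∸_; _≤_; _<_; _!)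
  open import Data.Nat.Divisibility using (∣⇒≤; m∣m*n)

  prime⇒2≤ : ∀ {p} → Prime p → 2 ≤ p
  prime⇒2≤ {suc (suc _)} _ = s≤s (s≤s z≤n)

  2≤p^g : ∀ {p g} → Prime p → 0 < g → 2 ≤ p ℕ.^ g
  2≤p^g {p} {suc g} p-prime _ = ℕ.*-mono-≤ (prime⇒2≤ p-prime) (ℕ.m^n>0 p {{prime⇒nonZero p-prime}} g)

  prime∤m! : ∀ {p} → Prime p → ∀ m → m < p → ¬ (p ∣ m !)
  prime∤m! p-prime zero    m<p p∣1 = ℕ.<⇒≱ (prime⇒2≤ p-prime) (∣⇒≤ p∣1)
  prime∤m! p-prime (suc m) m<p p∣m! with euclidsLemma (suc m) (m !) p-prime p∣m!
  ... | inj₁ p∣1+m = ℕ.<⇒≱ m<p (∣⇒≤ p∣1+m)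
  ... | inj₂ p∣m!′ = prime∤m! p-prime m (ℕ.<-trans (ℕ.n<1+n m) m<p) p∣m!′

  prime∣pCk : ∀ {p k} → Prime p → 0 < k → k < p → p ∣ p C k
  prime∣pCk {p@(suc q)} {k} p-prime 0<k k<p
    with euclidsLemma (p C k) (k ! * (p ∸ k) !) p-prime p∣pCk*k![p∸k]!
    where
    k≤p = ℕ.<⇒≤ k<p
    p∣pCk*k![p∸k]! : p ∣ (p C k) * (k ! * (p ∸ k) !)
    p∣pCk*k![p∸k]! = subst (p ∣_) (sym (trans (cong (_* (k ! * (p ∸ k) !)) (nCk≡n!/k![n-k]! k≤p))
      (m/n*n≡m {{ℕ._!*_!≢0 k (p ∸ k)}} (k![n∸k]!∣n! k≤p)))) (m∣m*n (q !))
  ... | inj₁ p∣pCk = p∣pCk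
  ... | inj₂ p∣k![p∸k]! with euclidsLemma (k !) ((p ∸ k) !) p-prime p∣k![p∸k]!
  ... | inj₁ p∣k! = ⊥-elim (prime∤m! p-prime k k<p p∣k!)
  ... | inj₂ p∣[p∸k]! = ⊥-elim (prime∤m! p-prime (p ∸ k) (ℕ.∸-monoʳ-< {p} {k} {0} 0<k (ℕ.<⇒≤ k<p)) p∣[p∸k]!)

  gcd[d,n]<n : ∀ {p n d} → gcd p n ≡ 1 → p ∣ d → 0 < d → d < n * p → gcd d n < n
  gcd[d,n]<n {p} {n} {d} gcd[p,n]≡1 p∣d 0<d d<np = ℕ.≤∧≢⇒< (gcd[m,n]≤n d n {{n≢0}}) g≢n
    where
    n≢0 : ℕ.NonZero n
    n≢0 = ℕ.≢-nonZero λ { refl → ℕ.<⇒≱ d<np z≤n }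
    g≢n : ¬ (gcd d n ≡ n)
    g≢n g≡n with subst (_∣ d) g≡n (gcd[m,n]∣m d n)
    ... | divides e d≡en = ℕ.<⇒≱ d<np (begin
      n * p   ≤⟨ ℕ.*-monoʳ-≤ n (∣⇒≤ {{e≢0}} p∣e) ⟩
      n * e   ≡⟨ trans (ℕ.*-comm n e) (sym d≡en) ⟩
      d       ∎)
      where
      open ℕ.≤-Reasoning
      e≢0 : ℕ.NonZero e
      e≢0 = ℕ.≢-nonZero λ { refl → ℕ.<⇒≢ 0<d (sym d≡en) }
      p∣e : p ∣ e
      p∣e = coprime-divisor (gcd≡1⇒coprime gcd[p,n]≡1) (subst (p ∣_) (trans d≡en (ℕ.*-comm e n)) p∣d)

module Frobenius (K : Field) {p : ℕ} (p-prime : Prime p)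
                 (char-p : FieldProperties.fromℕ K p ≡ Field.0# K) where
  open FieldProperties K
  open PrimeNat
  open ≡-Reasoning

  fromℕ-∣ : ∀ {m} → p ∣ m → fromℕ m ≡ 0#
  fromℕ-∣ (divides q refl) = trans (fromℕ-* q p) (trans (cong (fromℕ q *_) char-p) (zeroʳ _))

  private
    1+[p-1]≡p : suc (ℕ.pred p) ≡ p
    1+[p-1]≡p = ℕ.suc-pred p {{prime⇒nonZero p-prime}}

  +-^p : ∀ x y → (x + y) ^ p ≡ x ^ p + y ^ p
  +-^p x y = subst (λ n → (x + y) ^ n ≡ x ^ n + y ^ n) 1+[p-1]≡p (+-^-additive (ℕ.pred p) pCk≡0 x y)
    where
    pCk≡0 : ∀ k → 0 ℕ.< k → k ℕ.< suc (ℕ.pred p) → fromℕ (suc (ℕ.pred p) C k) ≡ 0#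
    pCk≡0 k 0<k k<p = fromℕ-∣ (subst (λ n → p ∣ n C k) (sym 1+[p-1]≡p)
                                  (prime∣pCk p-prime 0<k (subst (k ℕ.<_) 1+[p-1]≡p k<p)))

  0^p : 0# ^ p ≡ 0#
  0^p = subst (λ n → 0# ^ n ≡ 0#) 1+[p-1]≡p (0^suc (ℕ.pred p))

  -‿^p : ∀ x → (- x) ^ p ≡ - (x ^ p)
  -‿^p x = +-inverseʳ-unique (x ^ p) ((- x) ^ p)
    (trans (sym (+-^p x (- x))) (trans (cong (_^ p) (-‿inverseʳ x)) 0^p))

  fromℕ-^p : ∀ m → fromℕ m ^ p ≡ fromℕ m
  fromℕ-^p zero    = 0^p
  fromℕ-^p (suc m) = trans (+-^p 1# (fromℕ m)) (cong₂ _+_ (1^ p) (fromℕ-^p m))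

  frob : ℕ → Carrier → Carrier
  frob k x = x ^ (p ℕ.^ k)

  frob-zero : ∀ x → frob 0 x ≡ x
  frob-zero = *-identityʳ

  frob-suc : ∀ k x → frob (suc k) x ≡ frob k (x ^ p)
  frob-suc k x = ^-* x p (p ℕ.^ k)

  frob-compose : ∀ a b x → frob (a ℕ.+ b) x ≡ frob a (frob b x)
  frob-compose a b x = begin
    x ^ (p ℕ.^ (a ℕ.+ b))         ≡⟨ cong (x ^_) (trans (ℕ.^-distribˡ-+-* p a b) (ℕ.*-comm (p ℕ.^ a) (p ℕ.^ b))) ⟩
    x ^ (p ℕ.^ b ℕ.* p ℕ.^ a)     ≡⟨ ^-* x (p ℕ.^ b) (p ℕ.^ a) ⟩
    frob a (frob b x)             ∎

  frob-homo-+ : ∀ k x y → frob k (x + y) ≡ frob k x + frob k y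
  frob-homo-+ zero    x y = trans (frob-zero _) (sym (cong₂ _+_ (frob-zero x) (frob-zero y)))
  frob-homo-+ (suc k) x y = begin
    frob (suc k) (x + y)          ≡⟨ frob-suc k (x + y) ⟩
    frob k ((x + y) ^ p)          ≡⟨ cong (frob k) (+-^p x y) ⟩
    frob k (x ^ p + y ^ p)        ≡⟨ frob-homo-+ k _ _ ⟩
    frob k (x ^ p) + frob k (y ^ p) ≡⟨ cong₂ _+_ (frob-suc k x) (frob-suc k y) ⟨
    frob (suc k) x + frob (suc k) y ∎

  frob-homo-* : ∀ k x y → frob k (x * y) ≡ frob k x * frob k y
  frob-homo-* k x y = *-^ x y (p ℕ.^ k)

  frob-homo-‿ : ∀ k x → frob k (- x) ≡ - frob k x
  frob-homo-‿ zero    x = trans (frob-zero _) (cong -_ (sym (frob-zero x)))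
  frob-homo-‿ (suc k) x = begin
    frob (suc k) (- x)            ≡⟨ frob-suc k (- x) ⟩
    frob k ((- x) ^ p)            ≡⟨ cong (frob k) (-‿^p x) ⟩
    frob k (- (x ^ p))            ≡⟨ frob-homo-‿ k _ ⟩
    - frob k (x ^ p)              ≡⟨ cong -_ (frob-suc k x) ⟨
    - frob (suc k) x              ∎

  frob-homo-⁻¹ : ∀ k x → ¬ (x ≡ 0#) → frob k (x ⁻¹) ≡ frob k x ⁻¹
  frob-homo-⁻¹ k x = ⁻¹-^ x (p ℕ.^ k)

  frob-1# : ∀ k → frob k 1# ≡ 1#
  frob-1# k = 1^ (p ℕ.^ k)

  frob-0# : ∀ k → frob k 0# ≡ 0#
  frob-0# k = +-cancelʳ-0# (frob k 0#) (frob k 0#)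
    (trans (sym (frob-homo-+ k 0# 0#)) (cong (frob k) (+-identityʳ 0#)))

  frob-fromℕ : ∀ k m → frob k (fromℕ m) ≡ fromℕ m
  frob-fromℕ zero    m = frob-zero _
  frob-fromℕ (suc k) m = trans (frob-suc k (fromℕ m)) (trans (cong (frob k) (fromℕ-^p m)) (frob-fromℕ k m))

module FiniteFieldProperties {q : ℕ} (F : FiniteField q) where
  open FiniteField F public using (enum; to; count; Subfield; NotInSubfieldOfOrder)
  open FieldProperties (FiniteField.field′ F) public
  open SumFinProperties

  from : Carrier → Fin q
  from = Inverse.from enum

  to-from : ∀ x → to (from x) ≡ x
  to-from = Inverse.strictlyInverseˡ enum

  from-to : ∀ i → from (to i) ≡ i
  from-to = Inverse.strictlyInverseʳ enum

  infix 4 _≟_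
  _≟_ : DecidableEquality Carrier
  x ≟ y with from x Fin.≟ from y
  ... | yes e  = yes (trans (sym (to-from x)) (trans (cong to e) (to-from y)))
  ... | no ¬e  = no (¬e ∘ cong from)

  ≟-sound : ∀ {x y} → does (x ≟ y) ≡ true → x ≡ y
  ≟-sound {x} {y} = does-sound (x ≟ y)
    where
    does-sound : ∀ {A : Set} (a? : Dec A) → does a? ≡ true → A
    does-sound (yes a) _ = a

  ≟-complete : ∀ {x y} → x ≡ y → does (x ≟ y) ≡ true
  ≟-complete {x} {y} = dec-true (x ≟ y)

  count-bijection : (σ : Carrier ↔ Carrier) (P : Carrier → Bool) → count P ≡ count (P ∘ Inverse.to σ)
  count-bijection σ P = sumFin-bijection enum σ (λ x → if P x then 1 else 0)

  +-bijection : Carrier → Carrier ↔ Carrier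
  +-bijection c = mk↔ₛ′ (_+ c) (_+ - c) (cancel (- c) c (-‿inverseˡ c)) (cancel c (- c) (-‿inverseʳ c))
    where
    cancel : ∀ a b → a + b ≡ 0# → ∀ x → (x + a) + b ≡ x
    cancel a b a+b≡0 x = trans (+-assoc x a b) (trans (cong (x +_) a+b≡0) (+-identityʳ x))

  *-bijection : ∀ b → ¬ (b ≡ 0#) → Carrier ↔ Carrier
  *-bijection b b≢0 = mk↔ₛ′ (b *_) (b ⁻¹ *_) (cancel (inverseʳ b b≢0)) (cancel (inverseˡ b b≢0))
    where
    cancel : ∀ {a c} → a * c ≡ 1# → ∀ x → a * (c * x) ≡ x
    cancel {a} {c} ac≡1 x = trans (sym (*-assoc a c x)) (trans (cong (_* x) ac≡1) (*-identityˡ x))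

  -- Shifting every element by 1 leaves the sum of all elements unchanged.
  fromℕ-q≡0 : fromℕ q ≡ 0#
  fromℕ-q≡0 = +-cancelʳ-0# S (fromℕ q) (begin
    S + fromℕ q                      ≡⟨ cong (S +_) (sumK-1 q) ⟨
    S + sumK q (λ _ → 1#)            ≡⟨ sumK-+ q to (λ _ → 1#) ⟨
    sumK q (λ i → to i + 1#)         ≡⟨ sumK-bijection enum (+-bijection 1#) (λ x → x) ⟨
    S                                ∎)
    where
    open ≡-Reasoning
    S = sumK q to

  private
    module FermatFactors (b : Carrier) (b≢0 : ¬ (b ≡ 0#)) where
      open ≡-Reasoning
      -- b = h x * k x, where h contributes b away from 0 and k contributes b at 0.
      g h k : Carrier → Carrier
      g x with x ≟ 0#
      ... | yes _ = 1#
      ... | no _  = x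
      h x with x ≟ 0#
      ... | yes _ = 1#
      ... | no _  = b
      k x with x ≟ 0#
      ... | yes _ = b
      ... | no _  = 1#

      b≡h*k : ∀ x → b ≡ h x * k x
      b≡h*k x with x ≟ 0#
      ... | yes _ = sym (*-identityˡ b)
      ... | no _  = sym (*-identityʳ b)

      g≢0 : ∀ x → ¬ (g x ≡ 0#)
      g≢0 x with x ≟ 0#
      ... | yes _   = 1≢0
      ... | no x≢0  = x≢0

      g[bx]≡h*g : ∀ x → g (b * x) ≡ h x * g x
      g[bx]≡h*g x with x ≟ 0# | b * x ≟ 0#
      ... | yes _    | yes _    = sym (*-identityˡ 1#)
      ... | yes refl | no bx≢0  = ⊥-elim (bx≢0 (zeroʳ b))
      ... | no x≢0   | yes bx≡0 = ⊥-elim (x≢0∧y≢0⇒x*y≢0 b≢0 x≢0 bx≡0)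
      ... | no _     | no _     = refl

      -- multiplication by b permutes the field, so the product of g is unchanged
      ∏h≡1 : prodFin q (h ∘ to) ≡ 1#
      ∏h≡1 = *-cancelˡ G _ 1# (prodFin≢0 q (g ∘ to) (g≢0 ∘ to)) (begin
        G * prodFin q (h ∘ to)                 ≡⟨ *-comm _ _ ⟩
        prodFin q (h ∘ to) * G                 ≡⟨ prodFin-* q (h ∘ to) (g ∘ to) ⟨
        prodFin q (λ i → h (to i) * g (to i))  ≡⟨ prodFin-cong q (λ i → g[bx]≡h*g (to i)) ⟨
        prodFin q (λ i → g (b * to i))         ≡⟨ prodFin-bijection enum (*-bijection b b≢0) g ⟨
        G                                      ≡⟨ *-identityʳ G ⟨
        G * 1#                                 ∎)
        where G = prodFin q (g ∘ to)

      ∏k≡b : prodFin q (k ∘ to) ≡ b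
      ∏k≡b = trans (prodFin-single q (from 0#) (k ∘ to) k≡1) (k0≡b (to-from 0#))
        where
        k≡1 : ∀ i → ¬ (i ≡ from 0#) → k (to i) ≡ 1#
        k≡1 i i≢0 with to i ≟ 0#
        ... | yes e = ⊥-elim (i≢0 (trans (sym (from-to i)) (cong from e)))
        ... | no _  = refl
        k0≡b : ∀ {x} → x ≡ 0# → k x ≡ b
        k0≡b {x} x≡0 with x ≟ 0#
        ... | yes _   = refl
        ... | no x≢0  = ⊥-elim (x≢0 x≡0)

  x^q≡x : ∀ b → b ^ q ≡ b
  x^q≡x b with b ≟ 0#
  ... | yes refl = q≢0⇒0^q (from 0#)
    where
    q≢0⇒0^q : ∀ {n} → Fin n → 0# ^ n ≡ 0#
    q≢0⇒0^q {suc n} _ = 0^suc n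
  ... | no b≢0 = begin
    b ^ q                                   ≡⟨ prodFin-const q b ⟨
    prodFin q (λ _ → b)                     ≡⟨ prodFin-cong q (λ i → b≡h*k (to i)) ⟩
    prodFin q (λ i → h (to i) * k (to i))   ≡⟨ prodFin-* q (h ∘ to) (k ∘ to) ⟩
    prodFin q (h ∘ to) * prodFin q (k ∘ to) ≡⟨ cong₂ _*_ ∏h≡1 ∏k≡b ⟩
    1# * b                                  ≡⟨ *-identityˡ b ⟩
    b                                       ∎
    where
    open ≡-Reasoning
    open FermatFactors b b≢0

  indicator : Bool → ℕ
  indicator b = if b then 1 else 0

  count-mono : (P Q : Carrier → Bool) → (∀ x → P x ≡ true → Q x ≡ true) → count P ℕ.≤ count Q
  count-mono P Q P⊆Q = sumFin-mono q (λ i → indicator-mono (P⊆Q (to i)))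
    where
    indicator-mono : ∀ {a b} → (a ≡ true → b ≡ true) → indicator a ℕ.≤ indicator b
    indicator-mono {false}         _   = z≤n
    indicator-mono {true}  {true}  _   = ℕ.≤-refl
    indicator-mono {true}  {false} a⇒b with a⇒b refl
    ... | ()

  count-none : (P : Carrier → Bool) → (∀ x → P x ≡ false) → count P ≡ 0
  count-none P none = sumFin-zero q _ (λ i → cong indicator (none (to i)))

  count-∨ : (P Q : Carrier → Bool) → count (λ x → P x ∨ Q x) ℕ.≤ count P ℕ.+ count Q
  count-∨ P Q = ℕ.≤-trans (sumFin-mono q (λ i → indicator-∨ (P (to i)) (Q (to i))))
                          (ℕ.≤-reflexive (sumFin-+ q _ _))
    where
    indicator-∨ : ∀ a b → indicator (a ∨ b) ℕ.≤ indicator a ℕ.+ indicator b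
    indicator-∨ true  _     = s≤s z≤n
    indicator-∨ false true  = ℕ.≤-refl
    indicator-∨ false false = z≤n

  count-≟ : ∀ a → count (λ x → does (x ≟ a)) ≡ 1
  count-≟ a = trans (sumFin-single q (from a) _ off-a) (on-a (to-from a))
    where
    off-a : ∀ i → ¬ (i ≡ from a) → indicator (does (to i ≟ a)) ≡ 0
    off-a i i≢a = cong indicator (dec-false (to i ≟ a) (λ e → i≢a (trans (sym (from-to i)) (cong from e))))
    on-a : ∀ {x} → x ≡ a → indicator (does (x ≟ a)) ≡ 1
    on-a x≡a = cong indicator (≟-complete x≡a)

  -- Double counting: the fibres of ψ partition the field.
  count-fibres : (ψ : Carrier → Carrier) (R : Carrier → Bool) → (∀ x → R (ψ x) ≡ true) →
                 (c : ℕ) → (∀ y → R y ≡ true → count (λ x → does (y ≟ ψ x)) ℕ.≤ c) →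
                 q ℕ.≤ count R ℕ.* c
  count-fibres ψ R R∘ψ c fibre≤c = begin
    q                                                         ≡⟨ sumFin-1 q ⟨
    sumFin q (λ _ → 1)                                        ≡⟨ sumFin-cong q (λ i → count-≟ (ψ (to i))) ⟨
    sumFin q (λ i → count (λ y → does (y ≟ ψ (to i))))        ≡⟨ sumFin-comm q q _ ⟩
    sumFin q (λ j → count (λ x → does (to j ≟ ψ x)))          ≤⟨ sumFin-mono q (λ j → fibre≤ (to j)) ⟩
    sumFin q (λ j → indicator (R (to j)) ℕ.* c)               ≡⟨ sumFin-*ʳ q _ c ⟩
    count R ℕ.* c                                             ∎
    where
    open ℕ.≤-Reasoning
    fibre≤ : ∀ y → count (λ x → does (y ≟ ψ x)) ℕ.≤ indicator (R y) ℕ.* c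
    fibre≤ y with R y in eq
    ... | true  = subst (count (λ x → does (y ≟ ψ x)) ℕ.≤_) (sym (ℕ.*-identityˡ c)) (fibre≤c y eq)
    ... | false = ℕ.≤-reflexive (count-none _ empty)
      where
      empty : ∀ x → does (y ≟ ψ x) ≡ false
      empty x = dec-false (y ≟ ψ x) λ y≡ψx → false≢true (trans (sym eq) (trans (cong R y≡ψx) (R∘ψ x)))
        where
        false≢true : ¬ (false ≡ true)
        false≢true ()

  eval : List Carrier → Carrier → Carrier
  eval []       x = 0#
  eval (c ∷ cs) x = c + x * eval cs x

  -- The monic polynomial of degree length cs whose lower coefficients are cs.
  evalMonic : List Carrier → Carrier → Carrier
  evalMonic []       x = 1#
  evalMonic (c ∷ cs) x = c + x * evalMonic cs x

  -- Synthetic division of a monic polynomial by x - a.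
  divideBy : Carrier → List Carrier → List Carrier
  divideBy a []            = []
  divideBy a (c ∷ [])      = []
  divideBy a (c ∷ d ∷ cs)  = evalMonic (d ∷ cs) a ∷ divideBy a (d ∷ cs)

  length-divideBy : ∀ a c cs → length (divideBy a (c ∷ cs)) ≡ length cs
  length-divideBy a c []       = refl
  length-divideBy a c (d ∷ cs) = cong suc (length-divideBy a d cs)

  -- f(x) - f(a) = (x - a) g(x), with both sides moved so that no subtraction occurs.
  divideBy-correct : ∀ a c cs x → let f = c ∷ cs; g = divideBy a f in
                     evalMonic f x + a * evalMonic g x ≡ x * evalMonic g x + evalMonic f a
  divideBy-correct a c []       x = solve 3 (λ a c x → ((c ⊕ x ⊗ Κ 1#) ⊕ a ⊗ Κ 1#) ⊜ (x ⊗ Κ 1# ⊕ (c ⊕ a ⊗ Κ 1#))) refl a c x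
  divideBy-correct a c (d ∷ cs) x = begin
    (c + x * fx) + a * (fa + x * gx)   ≡⟨ solve 6 (λ c x fx a fa gx → ((c ⊕ x ⊗ fx) ⊕ a ⊗ (fa ⊕ x ⊗ gx)) ⊜ ((c ⊕ a ⊗ fa) ⊕ x ⊗ (fx ⊕ a ⊗ gx))) refl c x fx a fa gx ⟩
    (c + a * fa) + x * (fx + a * gx)   ≡⟨ cong (λ z → (c + a * fa) + x * z) (divideBy-correct a d cs x) ⟩
    (c + a * fa) + x * (x * gx + fa)   ≡⟨ solve 6 (λ c x fx a fa gx → ((c ⊕ a ⊗ fa) ⊕ x ⊗ (x ⊗ gx ⊕ fa)) ⊜ (x ⊗ (fa ⊕ x ⊗ gx) ⊕ (c ⊕ a ⊗ fa))) refl c x fx a fa gx ⟩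
    x * (fa + x * gx) + (c + a * fa)   ∎
    where
    open ≡-Reasoning
    fx = evalMonic (d ∷ cs) x
    fa = evalMonic (d ∷ cs) a
    gx = evalMonic (divideBy a (d ∷ cs)) x

  divideBy-root : ∀ a c cs x → evalMonic (c ∷ cs) a ≡ 0# → evalMonic (c ∷ cs) x ≡ 0# →
                  ¬ (evalMonic (divideBy a (c ∷ cs)) x ≡ 0#) → x ≡ a
  divideBy-root a c cs x fa≡0 fx≡0 gx≢0 = sym (*-cancelˡ gx a x gx≢0 (begin
    gx * a                                    ≡⟨ *-comm _ _ ⟩
    a * gx                                    ≡⟨ +-identityˡ _ ⟨
    0# + a * gx                               ≡⟨ cong (_+ a * gx) fx≡0 ⟨
    evalMonic (c ∷ cs) x + a * gx             ≡⟨ divideBy-correct a c cs x ⟩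
    x * gx + evalMonic (c ∷ cs) a             ≡⟨ cong (x * gx +_) fa≡0 ⟩
    x * gx + 0#                               ≡⟨ +-identityʳ _ ⟩
    x * gx                                    ≡⟨ *-comm _ _ ⟩
    gx * x                                    ∎))
    where
    open ≡-Reasoning
    gx = evalMonic (divideBy a (c ∷ cs)) x

  roots : List Carrier → Carrier → Bool
  roots cs x = does (evalMonic cs x ≟ 0#)

  count-roots≤degree : ∀ cs → count (roots cs) ℕ.≤ length cs
  count-roots≤degree cs = go (length cs) cs refl
    where
    go : ∀ n cs → length cs ≡ n → count (roots cs) ℕ.≤ n
    go zero    []       _ = ℕ.≤-reflexive (count-none _ (λ _ → dec-false (1# ≟ 0#) 1≢0))
    go (suc n) (c ∷ cs) len with any? (λ i → evalMonic (c ∷ cs) (to i) ≟ 0#)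
    ... | no no-root = ℕ.≤-trans (ℕ.≤-reflexive (count-none _ not-root)) z≤n
      where
      not-root : ∀ x → roots (c ∷ cs) x ≡ false
      not-root x = dec-false (evalMonic (c ∷ cs) x ≟ 0#)
        (λ fx≡0 → no-root (from x , trans (cong (evalMonic (c ∷ cs)) (to-from x)) fx≡0))
    ... | yes (i , fa≡0) = begin
      count (roots (c ∷ cs))                        ≤⟨ count-mono _ _ root⇒ ⟩
      count (λ x → does (x ≟ a) ∨ roots g x)        ≤⟨ count-∨ (λ x → does (x ≟ a)) (roots g) ⟩
      count (λ x → does (x ≟ a)) ℕ.+ count (roots g) ≤⟨ ℕ.+-mono-≤ (ℕ.≤-reflexive (count-≟ a))
                                                          (go n g (trans (length-divideBy a c cs) (ℕ.suc-injective len))) ⟩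
      suc n                                         ∎
      where
      open ℕ.≤-Reasoning
      a = to i
      g = divideBy a (c ∷ cs)
      root⇒ : ∀ x → roots (c ∷ cs) x ≡ true → (does (x ≟ a) ∨ roots g x) ≡ true
      root⇒ x fx≡0 with x ≟ a | evalMonic g x ≟ 0#
      ... | yes _ | _     = refl
      ... | no _  | yes _ = refl
      ... | no x≢a | no gx≢0 = ⊥-elim (x≢a (divideBy-root a c cs x fa≡0 (≟-sound fx≡0) gx≢0))

  padTo : ℕ → List Carrier → List Carrier
  padTo zero    cs       = []
  padTo (suc D) []       = 0# ∷ padTo D []
  padTo (suc D) (c ∷ cs) = c ∷ padTo D cs

  length-padTo : ∀ D cs → length (padTo D cs) ≡ D
  length-padTo zero    cs       = refl
  length-padTo (suc D) []       = cong suc (length-padTo D [])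
  length-padTo (suc D) (c ∷ cs) = cong suc (length-padTo D cs)

  evalMonic-padTo : ∀ D cs x → length cs ℕ.≤ D → evalMonic (padTo D cs) x ≡ eval cs x + x ^ D
  evalMonic-padTo zero    []       x _ = sym (+-identityˡ 1#)
  evalMonic-padTo (suc D) []       x _ = begin
    0# + x * evalMonic (padTo D []) x  ≡⟨ cong (λ z → 0# + x * z) (evalMonic-padTo D [] x z≤n) ⟩
    0# + x * (0# + x ^ D)              ≡⟨ cong (λ z → 0# + x * z) (+-identityˡ _) ⟩
    0# + x ^ suc D                     ∎
    where open ≡-Reasoning
  evalMonic-padTo (suc D) (c ∷ cs) x (s≤s cs≤D) = begin
    c + x * evalMonic (padTo D cs) x   ≡⟨ cong (λ z → c + x * z) (evalMonic-padTo D cs x cs≤D) ⟩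
    c + x * (eval cs x + x ^ D)        ≡⟨ solve 4 (λ c x a b → (c ⊕ x ⊗ (a ⊕ b)) ⊜ ((c ⊕ x ⊗ a) ⊕ x ⊗ b)) refl c x (eval cs x) (x ^ D) ⟩
    (c + x * eval cs x) + x ^ suc D    ∎
    where open ≡-Reasoning

  monomial : ℕ → List Carrier
  monomial zero    = 1# ∷ []
  monomial (suc e) = 0# ∷ monomial e

  length-monomial : ∀ e → length (monomial e) ≡ suc e
  length-monomial zero    = refl
  length-monomial (suc e) = cong suc (length-monomial e)

  eval-monomial : ∀ e x → eval (monomial e) x ≡ x ^ e
  eval-monomial zero    x = trans (cong (1# +_) (zeroʳ x)) (+-identityʳ 1#)
  eval-monomial (suc e) x = trans (+-identityˡ _) (cong (x *_) (eval-monomial e x))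

  infixl 6 _+ₚ_
  _+ₚ_ : List Carrier → List Carrier → List Carrier
  []       +ₚ ds       = ds
  (c ∷ cs) +ₚ []       = c ∷ cs
  (c ∷ cs) +ₚ (d ∷ ds) = c + d ∷ cs +ₚ ds

  eval-+ₚ : ∀ cs ds x → eval (cs +ₚ ds) x ≡ eval cs x + eval ds x
  eval-+ₚ []       ds       x = sym (+-identityˡ _)
  eval-+ₚ (c ∷ cs) []       x = sym (+-identityʳ _)
  eval-+ₚ (c ∷ cs) (d ∷ ds) x = trans (cong (λ z → (c + d) + x * z) (eval-+ₚ cs ds x))
    (solve 5 (λ c d x u v → ((c ⊕ d) ⊕ x ⊗ (u ⊕ v)) ⊜ ((c ⊕ x ⊗ u) ⊕ (d ⊕ x ⊗ v))) refl c d x (eval cs x) (eval ds x))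

  length-+ₚ : ∀ m cs ds → length cs ℕ.≤ m → length ds ℕ.≤ m → length (cs +ₚ ds) ℕ.≤ m
  length-+ₚ m       []       ds       _           ds≤m        = ds≤m
  length-+ₚ m       (c ∷ cs) []       cs≤m        _           = cs≤m
  length-+ₚ (suc m) (c ∷ cs) (d ∷ ds) (s≤s cs≤m) (s≤s ds≤m) = s≤s (length-+ₚ m cs ds cs≤m ds≤m)

  x^n≡0⇒x≡0 : ∀ {x} n → x ^ n ≡ 0# → x ≡ 0#
  x^n≡0⇒x≡0 {x} n xⁿ≡0 with x ≟ 0#
  ... | yes x≡0 = x≡0
  ... | no x≢0  = ⊥-elim (x^n≢0 n x≢0 xⁿ≡0)

  prodFin≡0⇒factor≡0 : ∀ N (f : Fin N → Carrier) → prodFin N f ≡ 0# → ∃ λ j → f j ≡ 0#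
  prodFin≡0⇒factor≡0 zero    f ∏≡0 = ⊥-elim (1≢0 ∏≡0)
  prodFin≡0⇒factor≡0 (suc N) f ∏≡0 with f zero ≟ 0#
  ... | yes f₀≡0 = zero , f₀≡0
  ... | no f₀≢0 with prodFin≡0⇒factor≡0 N (f ∘ suc) (*-cancelˡ (f zero) _ 0# f₀≢0 (trans ∏≡0 (sym (zeroʳ _))))
  ... | j , fj≡0 = suc j , fj≡0

module PrimePowerField {p n : ℕ} (p-prime : Prime p) (F : FiniteField (p ℕ.^ n)) where
  open FiniteFieldProperties F public
  open PrimeNat

  fromℕ-p≡0 : fromℕ p ≡ 0#
  fromℕ-p≡0 = x^n≡0⇒x≡0 n (trans (sym (fromℕ-^ p n)) fromℕ-q≡0)

  open Frobenius (FiniteField.field′ F) p-prime fromℕ-p≡0 public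

  frob-n : ∀ x → frob n x ≡ x
  frob-n = x^q≡x

  frob-injective : ∀ k {x y} → frob k x ≡ frob k y → x ≡ y
  frob-injective k {x} {y} e = x-y≡0⇒x≡y x y (x^n≡0⇒x≡0 (p ℕ.^ k) (begin
    frob k (x + - y)          ≡⟨ frob-homo-+ k x (- y) ⟩
    frob k x + frob k (- y)   ≡⟨ cong (frob k x +_) (frob-homo-‿ k y) ⟩
    frob k x + - frob k y     ≡⟨ cong (_+ - frob k y) e ⟩
    frob k y + - frob k y     ≡⟨ -‿inverseʳ _ ⟩
    0#                        ∎))
    where open ≡-Reasoning

  frob-multiple : ∀ a {x} → frob a x ≡ x → ∀ k → frob (k ℕ.* a) x ≡ x
  frob-multiple a {x} fixed zero    = frob-zero x
  frob-multiple a {x} fixed (suc k) =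
    trans (frob-compose a (k ℕ.* a) x) (trans (cong (frob a) (frob-multiple a fixed k)) fixed)

  frob-gcd : ∀ a b {x} → frob a x ≡ x → frob b x ≡ x → frob (gcd a b) x ≡ x
  frob-gcd a b {x} fa fb with Bézout.identity (gcd-GCD a b)
  ... | Bézout.+- u v g+vb≡ua = begin
    frob (gcd a b) x                     ≡⟨ cong (frob (gcd a b)) (frob-multiple b fb v) ⟨
    frob (gcd a b) (frob (v ℕ.* b) x)    ≡⟨ frob-compose (gcd a b) (v ℕ.* b) x ⟨
    frob (gcd a b ℕ.+ v ℕ.* b) x         ≡⟨ cong (λ k → frob k x) g+vb≡ua ⟩
    frob (u ℕ.* a) x                     ≡⟨ frob-multiple a fa u ⟩
    x                                    ∎
    where open ≡-Reasoning
  ... | Bézout.-+ u v g+ua≡vb = begin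
    frob (gcd a b) x                     ≡⟨ cong (frob (gcd a b)) (frob-multiple a fa u) ⟨
    frob (gcd a b) (frob (u ℕ.* a) x)    ≡⟨ frob-compose (gcd a b) (u ℕ.* a) x ⟨
    frob (gcd a b ℕ.+ u ℕ.* a) x         ≡⟨ cong (λ k → frob k x) g+ua≡vb ⟩
    frob (v ℕ.* b) x                     ≡⟨ frob-multiple b fb v ⟩
    x                                    ∎
    where open ≡-Reasoning

  Fixed : ℕ → Carrier → Bool
  Fixed g x = does (frob g x ≟ x)

  fixedSubfield : ℕ → Subfield
  fixedSubfield g = record
    { mem      = Fixed g
    ; has0     = ≟-complete (frob-0# g)
    ; has1     = ≟-complete (frob-1# g)
    ; closed+  = λ x y fx fy → ≟-complete (trans (frob-homo-+ g x y) (cong₂ _+_ (≟-sound fx) (≟-sound fy)))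
    ; closed*  = λ x y fx fy → ≟-complete (trans (frob-homo-* g x y) (cong₂ _*_ (≟-sound fx) (≟-sound fy)))
    ; closed-  = λ x fx → ≟-complete (trans (frob-homo-‿ g x) (cong -_ (≟-sound fx)))
    ; closed⁻¹ = λ x fx x≢0 → ≟-complete (trans (frob-homo-⁻¹ g x x≢0) (cong _⁻¹ (≟-sound fx)))
    }

  x^P-x : ℕ → List Carrier
  x^P-x P = padTo P (0# ∷ - 1# ∷ [])

  x^P≡x⇒root : ∀ P x → 2 ℕ.≤ P → x ^ P ≡ x → evalMonic (x^P-x P) x ≡ 0#
  x^P≡x⇒root P x 2≤P x^P≡x = begin
    evalMonic (x^P-x P) x                ≡⟨ evalMonic-padTo P _ x 2≤P ⟩
    (0# + x * (- 1# + x * 0#)) + x ^ P   ≡⟨ cong ((0# + x * (- 1# + x * 0#)) +_) x^P≡x ⟩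
    (0# + x * (- 1# + x * 0#)) + x       ≡⟨ cong (λ z → (0# + x * (- 1# + z)) + x) (zeroʳ x) ⟩
    (0# + x * (- 1# + 0#)) + x           ≡⟨ cong (_+ x) (+-identityˡ _) ⟩
    x * (- 1# + 0#) + x                  ≡⟨ cong (λ v → x * v + x) (+-identityʳ _) ⟩
    x * - 1# + x                         ≡⟨ cong (x * - 1# +_) (*-identityʳ x) ⟨
    x * - 1# + x * 1#                    ≡⟨ distribˡ x (- 1#) 1# ⟨
    x * (- 1# + 1#)                      ≡⟨ cong (x *_) (-‿inverseˡ 1#) ⟩
    x * 0#                               ≡⟨ zeroʳ x ⟩
    0#                                   ∎
    where open ≡-Reasoning

  count-Fixed≤ : ∀ g → 0 ℕ.< g → count (Fixed g) ℕ.≤ p ℕ.^ g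
  count-Fixed≤ g 0<g = begin
    count (Fixed g)                ≤⟨ count-mono (Fixed g) (roots (x^P-x P)) fixed⇒root ⟩
    count (roots (x^P-x P))        ≤⟨ count-roots≤degree (x^P-x P) ⟩
    length (x^P-x P)               ≡⟨ length-padTo P _ ⟩
    P                              ∎
    where
    open ℕ.≤-Reasoning
    P = p ℕ.^ g
    fixed⇒root : ∀ x → Fixed g x ≡ true → roots (x^P-x P) x ≡ true
    fixed⇒root x fixed = ≟-complete (x^P≡x⇒root P x (2≤p^g p-prime 0<g) (≟-sound fixed))

  Δ : ℕ → Carrier → Carrier
  Δ g x = frob g x + - x

  Δ-homo-+ : ∀ g x y → Δ g (x + y) ≡ Δ g x + Δ g y
  Δ-homo-+ g x y = trans (cong (_+ - (x + y)) (frob-homo-+ g x y))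
    (solve 4 (λ a b x y → ((a ⊕ b) ⊕ (⊝ (x ⊕ y))) ⊜ ((a ⊕ (⊝ x)) ⊕ (b ⊕ (⊝ y)))) refl (frob g x) (frob g y) x y)

  trace : ℕ → ℕ → Carrier → Carrier
  trace g zero    y = 0#
  trace g (suc m) y = trace g m y + frob (m ℕ.* g) y

  trace-Δ : ∀ g m x → trace g m (Δ g x) + x ≡ frob (m ℕ.* g) x
  trace-Δ g zero    x = trans (+-identityˡ x) (sym (frob-zero x))
  trace-Δ g (suc m) x = begin
    (trace g m (Δ g x) + frob (m ℕ.* g) (Δ g x)) + x
      ≡⟨ solve 3 (λ a b c → ((a ⊕ b) ⊕ c) ⊜ ((a ⊕ c) ⊕ b)) refl _ _ x ⟩
    (trace g m (Δ g x) + x) + frob (m ℕ.* g) (Δ g x)     ≡⟨ cong (_+ frob (m ℕ.* g) (Δ g x)) (trace-Δ g m x) ⟩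
    A + frob (m ℕ.* g) (frob g x + - x)                 ≡⟨ cong (A +_) (frob-homo-+ (m ℕ.* g) _ _) ⟩
    A + (frob (m ℕ.* g) (frob g x) + frob (m ℕ.* g) (- x)) ≡⟨ cong (λ z → A + (B + z)) (frob-homo-‿ (m ℕ.* g) x) ⟩
    A + (B + - A)                                       ≡⟨ trans (sym (+-assoc A B (- A))) (xyx⁻¹≈y A B) ⟩
    B                                                   ≡⟨ frob-compose (m ℕ.* g) g x ⟨
    frob (m ℕ.* g ℕ.+ g) x                              ≡⟨ cong (λ k → frob k x) (ℕ.+-comm (m ℕ.* g) g) ⟩
    frob (suc m ℕ.* g) x                                ∎
    where
    open ≡-Reasoning
    A = frob (m ℕ.* g) x
    B = frob (m ℕ.* g) (frob g x)

  traceLower : ℕ → ℕ → List Carrier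
  traceLower g zero    = []
  traceLower g (suc m) = traceLower g m +ₚ monomial (p ℕ.^ (m ℕ.* g))

  eval-traceLower : ∀ g m y → eval (traceLower g m) y ≡ trace g m y
  eval-traceLower g zero    y = refl
  eval-traceLower g (suc m) y = trans (eval-+ₚ (traceLower g m) _ y)
    (cong₂ _+_ (eval-traceLower g m y) (eval-monomial (p ℕ.^ (m ℕ.* g)) y))

  length-traceLower : ∀ g m → 0 ℕ.< g → length (traceLower g m) ℕ.≤ p ℕ.^ (m ℕ.* g)
  length-traceLower g zero    _   = z≤n
  length-traceLower g (suc m) 0<g = length-+ₚ _ (traceLower g m) _
    (ℕ.≤-trans (length-traceLower g m 0<g) (ℕ.<⇒≤ p^mg<p^[g+mg]))
    (ℕ.≤-trans (ℕ.≤-reflexive (length-monomial _)) p^mg<p^[g+mg])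
    where
    p^mg<p^[g+mg] : p ℕ.^ (m ℕ.* g) ℕ.< p ℕ.^ (g ℕ.+ m ℕ.* g)
    p^mg<p^[g+mg] = ℕ.^-monoʳ-< p (prime⇒2≤ p-prime) (ℕ.m<n+m (m ℕ.* g) 0<g)

  -- Over F, trace g (1 + m) is a monic polynomial of degree p ^ (m * g).
  traceMonic : ℕ → ℕ → List Carrier
  traceMonic g m = padTo (p ℕ.^ (m ℕ.* g)) (traceLower g m)

  evalMonic-traceMonic : ∀ g m y → 0 ℕ.< g → evalMonic (traceMonic g m) y ≡ trace g (suc m) y
  evalMonic-traceMonic g m y 0<g =
    trans (evalMonic-padTo _ (traceLower g m) y (length-traceLower g m 0<g))
          (cong (_+ frob (m ℕ.* g) y) (eval-traceLower g m y))

  Δ-fibre≤ : ∀ g y → count (λ x → does (y ≟ Δ g x)) ℕ.≤ count (Fixed g)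
  Δ-fibre≤ g y with any? (λ i → y ≟ Δ g (to i))
  ... | no empty = ℕ.≤-trans (ℕ.≤-reflexive (count-none _ not-in-fibre)) z≤n
    where
    not-in-fibre : ∀ x → does (y ≟ Δ g x) ≡ false
    not-in-fibre x = dec-false (y ≟ Δ g x) (λ y≡Δx → empty (from x , trans y≡Δx (cong (Δ g) (sym (to-from x)))))
  ... | yes (i , y≡Δx₀) = begin
    count (λ x → does (y ≟ Δ g x))             ≡⟨ count-bijection (+-bijection x₀) (λ x → does (y ≟ Δ g x)) ⟩
    count (λ z → does (y ≟ Δ g (z + x₀)))      ≤⟨ count-mono (λ z → does (y ≟ Δ g (z + x₀))) (Fixed g) shifted-fixed ⟩
    count (Fixed g)                            ∎
    where
    open ℕ.≤-Reasoning
    x₀ = to i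
    -- y = Δ (z + x₀) = Δ z + y forces Δ z = 0.
    shifted-fixed : ∀ z → does (y ≟ Δ g (z + x₀)) ≡ true → Fixed g z ≡ true
    shifted-fixed z y≡Δ[z+x₀] = ≟-complete (x-y≡0⇒x≡y _ z (+-cancelʳ-0# y (Δ g z)
      (trans (+-comm y (Δ g z)) (trans (cong (Δ g z +_) y≡Δx₀)
        (trans (sym (Δ-homo-+ g z x₀)) (sym (≟-sound y≡Δ[z+x₀])))))))

  count-Fixed≥ : ∀ g m → 0 ℕ.< g → n ≡ suc m ℕ.* g → p ℕ.^ g ℕ.≤ count (Fixed g)
  count-Fixed≥ g m 0<g n≡[1+m]g = ℕ.*-cancelʳ-≤ (p ℕ.^ g) c D {{ℕ.m^n≢0 p (m ℕ.* g) {{prime⇒nonZero p-prime}}}} (begin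
    p ℕ.^ g ℕ.* D                  ≡⟨ ℕ.^-distribˡ-+-* p g (m ℕ.* g) ⟨
    p ℕ.^ (g ℕ.+ m ℕ.* g)          ≡⟨ cong (p ℕ.^_) n≡[1+m]g ⟨
    p ℕ.^ n                        ≤⟨ count-fibres (Δ g) (roots (traceMonic g m)) Δ-root c (λ y _ → Δ-fibre≤ g y) ⟩
    count (roots (traceMonic g m)) ℕ.* c ≤⟨ ℕ.*-monoˡ-≤ c (count-roots≤degree (traceMonic g m)) ⟩
    length (traceMonic g m) ℕ.* c  ≡⟨ cong (ℕ._* c) (length-padTo D _) ⟩
    D ℕ.* c                        ≡⟨ ℕ.*-comm D c ⟩
    c ℕ.* D                        ∎)
    where
    open ℕ.≤-Reasoning
    D = p ℕ.^ (m ℕ.* g)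
    c = count (Fixed g)
    -- trace g (1 + m) (Δ x) = frob n x - x = 0
    Δ-root : ∀ x → roots (traceMonic g m) (Δ g x) ≡ true
    Δ-root x = ≟-complete (trans (evalMonic-traceMonic g m (Δ g x) 0<g)
      (+-cancelʳ-0# x _ (trans (+-comm x _) (trans (trace-Δ g (suc m) x)
        (trans (cong (λ k → frob k x) (sym n≡[1+m]g)) (frob-n x))))))

  count-Fixed : ∀ g → 0 ℕ.< g → g ∣ n → 0 ℕ.< n → count (Fixed g) ≡ p ℕ.^ g
  count-Fixed g 0<g (divides (suc m) n≡[1+m]g) _ = ℕ.≤-antisym (count-Fixed≤ g 0<g) (count-Fixed≥ g m 0<g n≡[1+m]g)
  count-Fixed g 0<g (divides zero n≡0) 0<n = ⊥-elim (ℕ.<⇒≢ 0<n (sym n≡0))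

  1+a≢b : ∀ {a b} → fromℕ a ≡ 0# → fromℕ b ≡ 0# → ¬ (suc a ≡ b)
  1+a≢b {a} {b} a≡0 b≡0 1+a≡b = 1≢0 (begin
    1#                ≡⟨ +-identityʳ 1# ⟨
    1# + 0#           ≡⟨ cong (1# +_) a≡0 ⟨
    fromℕ (suc a)     ≡⟨ cong fromℕ 1+a≡b ⟩
    fromℕ b           ≡⟨ b≡0 ⟩
    0#                ∎)
    where open ≡-Reasoning

  fromℕ-*≡0 : ∀ x {a} → fromℕ a ≡ 0# → fromℕ (x ℕ.* a) ≡ 0#
  fromℕ-*≡0 x a≡0 = trans (fromℕ-* x _) (trans (cong (fromℕ x *_) a≡0) (zeroʳ _))

  fromℕ≢0 : ∀ r → 0 ℕ.< r → r ℕ.< p → ¬ (fromℕ r ≡ 0#)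
  fromℕ≢0 r@(suc _) _ r<p r≡0 with coprime-Bézout (prime⇒coprime p-prime r<p)
  ... | Bézout.+- x y 1+yr≡xp = 1+a≢b (fromℕ-*≡0 y r≡0) (fromℕ-*≡0 x fromℕ-p≡0) 1+yr≡xp
  ... | Bézout.-+ x y 1+xp≡yr = 1+a≢b (fromℕ-*≡0 x fromℕ-p≡0) (fromℕ-*≡0 y r≡0) 1+xp≡yr

  fromℕ≡0⇒p∣ : ∀ m → fromℕ m ≡ 0# → p ∣ m
  fromℕ≡0⇒p∣ m m≡0 = m%n≡0⇒n∣m m p {{p≢0}} r≡0
    where
    instance p≢0 = prime⇒nonZero p-prime
    r = m % p
    fromℕ-r≡0 : fromℕ r ≡ 0#
    fromℕ-r≡0 = +-cancelʳ-0# (fromℕ (m / p ℕ.* p)) (fromℕ r) (begin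
      fromℕ (m / p ℕ.* p) + fromℕ r   ≡⟨ fromℕ-+ (m / p ℕ.* p) r ⟨
      fromℕ (m / p ℕ.* p ℕ.+ r)       ≡⟨ cong fromℕ (trans (ℕ.+-comm _ r) (sym (m≡m%n+[m/n]*n m p))) ⟩
      fromℕ m                         ≡⟨ m≡0 ⟩
      0#                              ≡⟨ fromℕ-*≡0 (m / p) fromℕ-p≡0 ⟨
      fromℕ (m / p ℕ.* p)             ∎)
      where open ≡-Reasoning
    r≡0 : r ≡ 0
    r≡0 with r ℕ.≟ 0
    ... | yes r≡0 = r≡0
    ... | no r≢0  = ⊥-elim (fromℕ≢0 r (ℕ.n≢0⇒n>0 r≢0) (m%n<n m p) fromℕ-r≡0)

  frob-iterate : ∀ d y → y ≡ fromℕ d + frob d y → ∀ k → y ≡ fromℕ (k ℕ.* d) + frob (k ℕ.* d) y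
  frob-iterate d y y≡ zero    = sym (trans (+-identityˡ _) (frob-zero y))
  frob-iterate d y y≡ (suc k) = begin
    y                                                         ≡⟨ frob-iterate d y y≡ k ⟩
    fromℕ (k ℕ.* d) + frob (k ℕ.* d) y                        ≡⟨ cong (λ z → fromℕ (k ℕ.* d) + frob (k ℕ.* d) z) y≡ ⟩
    fromℕ (k ℕ.* d) + frob (k ℕ.* d) (fromℕ d + frob d y)     ≡⟨ cong (fromℕ (k ℕ.* d) +_) (frob-homo-+ (k ℕ.* d) _ _) ⟩
    fromℕ (k ℕ.* d) + (frob (k ℕ.* d) (fromℕ d) + frob (k ℕ.* d) (frob d y))
      ≡⟨ cong₂ (λ u v → fromℕ (k ℕ.* d) + (u + v)) (frob-fromℕ (k ℕ.* d) d) (sym (frob-compose (k ℕ.* d) d y)) ⟩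
    fromℕ (k ℕ.* d) + (fromℕ d + frob (k ℕ.* d ℕ.+ d) y)      ≡⟨ solve 3 (λ a b c → (a ⊕ (b ⊕ c)) ⊜ ((b ⊕ a) ⊕ c)) refl _ _ _ ⟩
    (fromℕ d + fromℕ (k ℕ.* d)) + frob (k ℕ.* d ℕ.+ d) y      ≡⟨ cong₂ _+_ (sym (fromℕ-+ d (k ℕ.* d))) (cong (λ z → frob z y) (ℕ.+-comm (k ℕ.* d) d)) ⟩
    fromℕ (suc k ℕ.* d) + frob (suc k ℕ.* d) y                ∎
    where open ≡-Reasoning

  shift : Carrier → ℕ → Carrier
  shift b j = fromℕ j + frob j b

  module _ (b : Carrier) (gcd[p,n]≡1 : gcd p n ≡ 1) (0<n : 0 ℕ.< n)
           (b∉ : ∀ m → m ∣ n → m ℕ.< n → NotInSubfieldOfOrder (p ℕ.^ m) b) where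

    -- Equal shifts j and j + d make frob j b a solution of y = d + frob d y;
    -- iterating this n times shows p ∣ d, so b is fixed by frob d and hence by frob (gcd d n).
    shift-injective : ∀ j d → 0 ℕ.< d → j ℕ.+ d ℕ.< n ℕ.* p → ¬ (shift b j ≡ shift b (j ℕ.+ d))
    shift-injective j d 0<d j+d<np shift≡ =
      b∉ g (gcd[m,n]∣n d n) g<n (fixedSubfield g) (count-Fixed g 0<g (gcd[m,n]∣n d n) 0<n)
         (≟-complete (frob-gcd d n frob-d-b≡b (frob-n b)))
      where
      open ≡-Reasoning
      y = frob j b
      g = gcd d n

      y≡d+frob-d-y : y ≡ fromℕ d + frob d y
      y≡d+frob-d-y = +-cancelˡ (fromℕ j) _ _ (begin
        fromℕ j + y                              ≡⟨ shift≡ ⟩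
        fromℕ (j ℕ.+ d) + frob (j ℕ.+ d) b       ≡⟨ cong₂ _+_ (fromℕ-+ j d) (trans (cong (λ k → frob k b) (ℕ.+-comm j d)) (frob-compose d j b)) ⟩
        (fromℕ j + fromℕ d) + frob d y           ≡⟨ +-assoc _ _ _ ⟩
        fromℕ j + (fromℕ d + frob d y)           ∎)

      p∣d : p ∣ d
      p∣d = coprime-divisor (gcd≡1⇒coprime gcd[p,n]≡1) (fromℕ≡0⇒p∣ (n ℕ.* d) (+-cancelʳ-0# y _ (begin
        y + fromℕ (n ℕ.* d)                      ≡⟨ +-comm _ _ ⟩
        fromℕ (n ℕ.* d) + y                      ≡⟨ cong (fromℕ (n ℕ.* d) +_) frob-nd-y≡y ⟨
        fromℕ (n ℕ.* d) + frob (n ℕ.* d) y       ≡⟨ frob-iterate d y y≡d+frob-d-y n ⟨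
        y                                        ∎)))
        where
        frob-nd-y≡y : frob (n ℕ.* d) y ≡ y
        frob-nd-y≡y = trans (cong (λ k → frob k y) (ℕ.*-comm n d)) (frob-multiple n (frob-n y) d)

      frob-d-b≡b : frob d b ≡ b
      frob-d-b≡b = frob-injective j (begin
        frob j (frob d b)                        ≡⟨ frob-compose j d b ⟨
        frob (j ℕ.+ d) b                         ≡⟨ cong (λ k → frob k b) (ℕ.+-comm j d) ⟩
        frob (d ℕ.+ j) b                         ≡⟨ frob-compose d j b ⟩
        frob d y                                 ≡⟨ +-identityˡ _ ⟨
        0# + frob d y                            ≡⟨ cong (_+ frob d y) (fromℕ-∣ p∣d) ⟨
        fromℕ d + frob d y                       ≡⟨ y≡d+frob-d-y ⟨
        y                                        ∎)

      0<g : 0 ℕ.< g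
      0<g = ℕ.n≢0⇒n>0 (gcd[m,n]≢0 d n (inj₂ (ℕ.n>0⇒n≢0 0<n)))

      g<n : g ℕ.< n
      g<n = gcd[d,n]<n gcd[p,n]≡1 p∣d 0<d (ℕ.≤-<-trans (ℕ.m≤n+m d j) j+d<np)

    shift-increasing : ∀ (i j : Fin (n ℕ.* p)) → toℕ i ℕ.< toℕ j → ¬ (shift b (toℕ i) ≡ shift b (toℕ j))
    shift-increasing i j i<j = subst (λ k → ¬ (shift b (toℕ i) ≡ shift b k)) i+d≡j
      (shift-injective (toℕ i) d (ℕ.m<n⇒0<n∸m i<j) (subst (ℕ._< n ℕ.* p) (sym i+d≡j) (Fin.toℕ<n j)))
      where
      d = toℕ j ℕ.∸ toℕ i
      i+d≡j : toℕ i ℕ.+ d ≡ toℕ j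
      i+d≡j = ℕ.m+[n∸m]≡n (ℕ.<⇒≤ i<j)

    shift-injectiveFin : ∀ (i j : Fin (n ℕ.* p)) → shift b (toℕ i) ≡ shift b (toℕ j) → i ≡ j
    shift-injectiveFin i j e with ℕ.<-cmp (toℕ i) (toℕ j)
    ... | tri≈ _ i≡j _ = Fin.toℕ-injective i≡j
    ... | tri< i<j _ _ = ⊥-elim (shift-increasing i j i<j e)
    ... | tri> _ _ j<i = ⊥-elim (shift-increasing j i j<i (sym e))

module LinearFactorPolynomials (F : Field) where
  open Field F

  coefficient : List Carrier → ℕ → Carrier
  coefficient []       i       = 0#
  coefficient (c ∷ cs) zero    = c
  coefficient (c ∷ cs) (suc i) = coefficient cs i

  addToConstant : Carrier → List Carrier → List Carrier
  addToConstant a []       = a ∷ []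
  addToConstant a (c ∷ cs) = a + c ∷ cs

  -- multiplication by c + x
  mulLinear : Carrier → List Carrier → List Carrier
  mulLinear c []       = []
  mulLinear c (a ∷ as) = c * a ∷ addToConstant a (mulLinear c as)

  mulLinearPow : Carrier → ℕ → List Carrier → List Carrier
  mulLinearPow c zero    cs = cs
  mulLinearPow c (suc k) cs = mulLinear c (mulLinearPow c k cs)

  -- ∏ i (c i + x) ^ a i
  linearFactorProduct : (N : ℕ) → (Fin N → Carrier) → (Fin N → ℕ) → List Carrier
  linearFactorProduct zero    c a = 1# ∷ []
  linearFactorProduct (suc N) c a = mulLinearPow (c zero) (a zero) (linearFactorProduct N (c ∘ suc) (a ∘ suc))

  length-mulLinear : ∀ c cs → length (mulLinear c cs) ℕ.≤ suc (length cs)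
  length-mulLinear c []       = z≤n
  length-mulLinear c (a ∷ as) = s≤s (length-addToConstant {a} {mulLinear c as} (length-mulLinear c as))
    where
    length-addToConstant : ∀ {a cs k} → length cs ℕ.≤ suc k → length (addToConstant a cs) ℕ.≤ suc k
    length-addToConstant {cs = []}    _  = s≤s z≤n
    length-addToConstant {cs = _ ∷ _} le = le

  length-mulLinearPow : ∀ c k cs → length (mulLinearPow c k cs) ℕ.≤ k ℕ.+ length cs
  length-mulLinearPow c zero    cs = ℕ.≤-refl
  length-mulLinearPow c (suc k) cs = ℕ.≤-trans (length-mulLinear c (mulLinearPow c k cs)) (s≤s (length-mulLinearPow c k cs))

  length-linearFactorProduct : ∀ N c a → length (linearFactorProduct N c a) ℕ.≤ suc (sumFin N a)
  length-linearFactorProduct zero    c a = ℕ.≤-refl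
  length-linearFactorProduct (suc N) c a = ℕ.≤-trans (length-mulLinearPow _ (a zero) _)
    (ℕ.≤-trans (ℕ.+-monoʳ-≤ (a zero) (length-linearFactorProduct N (c ∘ suc) (a ∘ suc)))
               (ℕ.≤-reflexive (ℕ.+-suc (a zero) _)))

module EvaluationAlong (F K : Field) (h : Field.Carrier F → Field.Carrier K)
  (h-+ : ∀ a b → h (Field._+_ F a b) ≡ Field._+_ K (h a) (h b))
  (h-* : ∀ a b → h (Field._*_ F a b) ≡ Field._*_ K (h a) (h b))
  (h-1 : h (Field.1# F) ≡ Field.1# K) where
  private module F = Field F
  open FieldProperties K
  open LinearFactorPolynomials F
  open ≡-Reasoning

  h-0 : h F.0# ≡ 0#
  h-0 = +-cancelʳ-0# (h F.0#) (h F.0#) (trans (sym (h-+ F.0# F.0#)) (cong h (FieldProperties.+-identityʳ F F.0#)))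

  evalAlong : List F.Carrier → Carrier → Carrier
  evalAlong []       x = 0#
  evalAlong (c ∷ cs) x = h c + x * evalAlong cs x

  evalAlong-coefficients : ∀ P cs x → length cs ℕ.≤ P →
                           evalAlong cs x ≡ sumK P (λ i → h (coefficient cs (toℕ i)) * x ^ toℕ i)
  evalAlong-coefficients zero    []       x _ = refl
  evalAlong-coefficients (suc P) []       x _ =
    sym (sumK-zero (suc P) _ (λ i → trans (cong (_* (x ^ toℕ i)) h-0) (zeroˡ _)))
  evalAlong-coefficients (suc P) (c ∷ cs) x (s≤s cs≤P) = begin
    h c + x * evalAlong cs x                                      ≡⟨ cong₂ _+_ (*-identityʳ (h c)) (cong (x *_) (sym (evalAlong-coefficients P cs x cs≤P))) ⟨
    h c * 1# + x * sumK P (λ i → h (coefficient cs (toℕ i)) * x ^ toℕ i)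
                                                                  ≡⟨ cong (h c * 1# +_) (sumK-*ˡ P x _) ⟩
    h c * 1# + sumK P (λ i → x * (h (coefficient cs (toℕ i)) * x ^ toℕ i))
                                                                  ≡⟨ cong (h c * 1# +_) (sumK-cong P (λ i → solve 3 (λ x a b → (x ⊗ (a ⊗ b)) ⊜ (a ⊗ (x ⊗ b))) refl x _ _)) ⟩
    h c * 1# + sumK P (λ i → h (coefficient cs (toℕ i)) * (x * x ^ toℕ i)) ∎

  evalAlong-mulLinear : ∀ c cs x → evalAlong (mulLinear c cs) x ≡ (h c + x) * evalAlong cs x
  evalAlong-mulLinear c []       x = sym (zeroʳ _)
  evalAlong-mulLinear c (a ∷ as) x = begin
    h (c F.* a) + x * evalAlong (addToConstant a (mulLinear c as)) x ≡⟨ cong₂ (λ u v → u + x * v) (h-* c a) (evalAlong-addToConstant a (mulLinear c as)) ⟩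
    h c * h a + x * (h a + evalAlong (mulLinear c as) x)             ≡⟨ cong (λ z → h c * h a + x * (h a + z)) (evalAlong-mulLinear c as x) ⟩
    h c * h a + x * (h a + (h c + x) * evalAlong as x)               ≡⟨ solve 4 (λ hc ha x e → ((hc ⊗ ha) ⊕ x ⊗ (ha ⊕ (hc ⊕ x) ⊗ e)) ⊜ ((hc ⊕ x) ⊗ (ha ⊕ x ⊗ e))) refl (h c) (h a) x (evalAlong as x) ⟩
    (h c + x) * (h a + x * evalAlong as x)                           ∎
    where
    evalAlong-addToConstant : ∀ a cs → evalAlong (addToConstant a cs) x ≡ h a + evalAlong cs x
    evalAlong-addToConstant a []       = trans (cong (h a +_) (zeroʳ x)) (trans (+-identityʳ _) (sym (+-identityʳ _)))
    evalAlong-addToConstant a (b ∷ bs) = trans (cong (_+ x * evalAlong bs x) (h-+ a b)) (+-assoc _ _ _)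

  evalAlong-mulLinearPow : ∀ c k cs x → evalAlong (mulLinearPow c k cs) x ≡ (h c + x) ^ k * evalAlong cs x
  evalAlong-mulLinearPow c zero    cs x = sym (*-identityˡ _)
  evalAlong-mulLinearPow c (suc k) cs x = trans (evalAlong-mulLinear c (mulLinearPow c k cs) x)
    (trans (cong ((h c + x) *_) (evalAlong-mulLinearPow c k cs x)) (sym (*-assoc _ _ _)))

  evalAlong-linearFactorProduct : ∀ N c a x →
    evalAlong (linearFactorProduct N c a) x ≡ prodFin N (λ i → (h (c i) + x) ^ a i)
  evalAlong-linearFactorProduct zero    c a x = trans (cong₂ _+_ h-1 (zeroʳ x)) (+-identityʳ 1#)
  evalAlong-linearFactorProduct (suc N) c a x =
    trans (evalAlong-mulLinearPow (c zero) (a zero) _ x)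
          (cong ((h (c zero) + x) ^ a zero *_) (evalAlong-linearFactorProduct N (c ∘ suc) (a ∘ suc) x))

module ArtinSchreier {q : ℕ} (F : FiniteField q) {p : ℕ} (E : ArtinSchreierExt F p) where
  private
    module F = FiniteFieldProperties F
  open ArtinSchreierExt E using (K; ι; ι-+; ι-*; ι-1; θ; unique)
  open FieldProperties K
  open LinearFactorPolynomials (FiniteField.field′ F)
  open SumFinProperties
  module ViaK = EvaluationAlong (FiniteField.field′ F) K ι ι-+ ι-* ι-1
  module ViaF = EvaluationAlong (FiniteField.field′ F) (FiniteField.field′ F) (λ x → x) (λ _ _ → refl) (λ _ _ → refl) refl

  -- 1, θ, …, θ ^ (p - 1) are linearly independent over F.
  θ-evaluation-faithful : ∀ cs ds → length cs ℕ.≤ p → length ds ℕ.≤ p →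
                          ViaK.evalAlong cs θ ≡ ViaK.evalAlong ds θ → ∀ x → ViaF.evalAlong cs x ≡ ViaF.evalAlong ds x
  θ-evaluation-faithful cs ds cs≤p ds≤p cs[θ]≡ds[θ] x =
    trans (ViaF.evalAlong-coefficients p cs x cs≤p)
          (trans (F.sumK-cong p (λ i → cong (F._* (x F.^ toℕ i)) (same-coefficients i)))
                 (sym (ViaF.evalAlong-coefficients p ds x ds≤p)))
    where
    same-coefficients : ∀ i → coefficient cs (toℕ i) ≡ coefficient ds (toℕ i)
    same-coefficients = unique (λ i → coefficient cs (toℕ i)) (λ i → coefficient ds (toℕ i))
      (trans (sym (ViaK.evalAlong-coefficients p cs θ cs≤p))
             (trans cs[θ]≡ds[θ] (ViaK.evalAlong-coefficients p ds θ ds≤p)))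

  -- Otherwise x + y = 0 as polynomials over F; evaluate at y = 1 - x.
  ι+θ≢0 : 2 ℕ.≤ p → ∀ x → ¬ (ι x + θ ≡ 0#)
  ι+θ≢0 2≤p x x+θ≡0 = F.1≢0 (begin
    F.1#                                          ≡⟨ F.+-identityʳ F.1# ⟨
    F.1# F.+ F.0#                                 ≡⟨ cong (F.1# F.+_) (F.-‿inverseʳ x) ⟨
    F.1# F.+ (x F.+ F.- x)                        ≡⟨ F.solve 2 (λ x o → (o F.⊕ (x F.⊕ (F.⊝ x))) F.⊜ (x F.⊕ (o F.⊕ (F.⊝ x)))) refl x F.1# ⟩
    x F.+ y                                       ≡⟨ cong (x F.+_) (trans (cong (y F.*_) (trans (cong (F.1# F.+_) (F.zeroʳ y)) (F.+-identityʳ F.1#))) (F.*-identityʳ y)) ⟨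
    ViaF.evalAlong (x ∷ F.1# ∷ []) y              ≡⟨ θ-evaluation-faithful (x ∷ F.1# ∷ []) [] 2≤p z≤n x+θ≡0′ y ⟩
    F.0#                                          ∎)
    where
    open ≡-Reasoning
    y = F.1# F.+ F.- x
    x+θ≡0′ : ViaK.evalAlong (x ∷ F.1# ∷ []) θ ≡ 0#
    x+θ≡0′ = begin
      ι x + θ * (ι F.1# + θ * 0#)   ≡⟨ cong (λ z → ι x + θ * (z + θ * 0#)) ι-1 ⟩
      ι x + θ * (1# + θ * 0#)       ≡⟨ cong (λ z → ι x + θ * (1# + z)) (zeroʳ θ) ⟩
      ι x + θ * (1# + 0#)           ≡⟨ cong (λ z → ι x + θ * z) (+-identityʳ 1#) ⟩
      ι x + θ * 1#                  ≡⟨ cong (ι x +_) (*-identityʳ θ) ⟩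
      ι x + θ                       ≡⟨ x+θ≡0 ⟩
      0#                            ∎

  module _ (2≤p : 2 ℕ.≤ p) {N : ℕ} (c : Fin N → FiniteField.Carrier F)
           (c-injective : ∀ i j → c i ≡ c j → i ≡ j) where

    factor : Fin N → Carrier
    factor i = ι (c i) + θ

    factorProduct : (Fin N → ℕ) → Carrier
    factorProduct a = prodFin N (λ i → factor i ^ a i)

    -- Both sides are images of polynomials over F of degree < p.
    factorProduct-injective-over-F : ∀ a b → sumFin N a ℕ.< p → sumFin N b ℕ.< p →
      factorProduct a ≡ factorProduct b →
      ∀ x → F.prodFin N (λ i → (c i F.+ x) F.^ a i) ≡ F.prodFin N (λ i → (c i F.+ x) F.^ b i)
    factorProduct-injective-over-F a b Σa<p Σb<p a≡b x = begin
      F.prodFin N (λ i → (c i F.+ x) F.^ a i)        ≡⟨ ViaF.evalAlong-linearFactorProduct N c a x ⟨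
      ViaF.evalAlong (linearFactorProduct N c a) x   ≡⟨ θ-evaluation-faithful (linearFactorProduct N c a) (linearFactorProduct N c b) (degree<p a Σa<p) (degree<p b Σb<p) over-K x ⟩
      ViaF.evalAlong (linearFactorProduct N c b) x   ≡⟨ ViaF.evalAlong-linearFactorProduct N c b x ⟩
      F.prodFin N (λ i → (c i F.+ x) F.^ b i)        ∎
      where
      open ≡-Reasoning
      degree<p : ∀ a → sumFin N a ℕ.< p → length (linearFactorProduct N c a) ℕ.≤ p
      degree<p a Σa<p = ℕ.≤-trans (length-linearFactorProduct N c a) Σa<p
      over-K : ViaK.evalAlong (linearFactorProduct N c a) θ ≡ ViaK.evalAlong (linearFactorProduct N c b) θ
      over-K = trans (ViaK.evalAlong-linearFactorProduct N c a θ)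
                     (trans a≡b (sym (ViaK.evalAlong-linearFactorProduct N c b θ)))

    -- Evaluating at - c j kills the left-hand side.
    exponent-positive : ∀ a b j → 0 ℕ.< a j → sumFin N a ℕ.< p → sumFin N b ℕ.< p →
                        factorProduct a ≡ factorProduct b → 0 ℕ.< b j
    exponent-positive a b j 0<aj Σa<p Σb<p a≡b with F.prodFin≡0⇒factor≡0 N (λ i → (c i F.+ F.- c j) F.^ b i) (trans
        (sym (factorProduct-injective-over-F a b Σa<p Σb<p a≡b (F.- c j)))
        (F.prodFin-zero N _ j (cj-cj^k≡0 (a j) 0<aj)))
      where
      cj-cj^k≡0 : ∀ k → 0 ℕ.< k → (c j F.+ F.- c j) F.^ k ≡ F.0#
      cj-cj^k≡0 (suc k) _ = trans (cong (F._* ((c j F.+ F.- c j) F.^ k)) (F.-‿inverseʳ (c j))) (F.zeroˡ _)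
    ... | i , ci-cj^bi≡0 = subst (λ i → 0 ℕ.< b i) (c-injective i j ci≡cj) (0<k (b i) ci-cj^bi≡0)
      where
      ci≡cj : c i ≡ c j
      ci≡cj = F.x-y≡0⇒x≡y _ _ (F.x^n≡0⇒x≡0 (b i) ci-cj^bi≡0)
      0<k : ∀ k → (c i F.+ F.- c j) F.^ k ≡ F.0# → 0 ℕ.< k
      0<k zero    1≡0 = ⊥-elim (F.1≢0 1≡0)
      0<k (suc k) _   = s≤s z≤n

    exponents-unique : ∀ a b → sumFin N a ℕ.< p → sumFin N b ℕ.< p →
                       factorProduct a ≡ factorProduct b → ∀ i → a i ≡ b i
    exponents-unique a b = go (sumFin N a) a b refl
      where
      go : ∀ k a b → sumFin N a ≡ k → sumFin N a ℕ.< p → sumFin N b ℕ.< p →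
           factorProduct a ≡ factorProduct b → ∀ i → a i ≡ b i
      go k a b Σa≡k Σa<p Σb<p a≡b with any? (λ j → 0 ℕ.<? a j)
      ... | no a≡0 = λ i → trans (zero-exponent a (λ 0<ai → a≡0 (i , 0<ai)))
                                 (sym (zero-exponent b (λ 0<bi → a≡0 (i , exponent-positive b a i 0<bi Σb<p Σa<p (sym a≡b)))))
        where
        zero-exponent : ∀ {i} (a : Fin N → ℕ) → ¬ (0 ℕ.< a i) → a i ≡ 0
        zero-exponent {i} a ¬0<ai = ℕ.n≤0⇒n≡0 (ℕ.≮⇒≥ ¬0<ai)
      ... | yes (j , 0<aj) = decrementAt-injective j a b 0<aj 0<bj (go′ k Σa≡k)
        where
        0<bj = exponent-positive a b j 0<aj Σa<p Σb<p a≡b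
        Σa≡1+Σa′ = sumFin-decrementAt N j a 0<aj
        Σb≡1+Σb′ = sumFin-decrementAt N j b 0<bj
        a′≡b′ : factorProduct (decrementAt j a) ≡ factorProduct (decrementAt j b)
        a′≡b′ = *-cancelˡ (factor j) _ _ (ι+θ≢0 2≤p (c j))
          (trans (sym (prodFin-^-decrementAt N j factor a 0<aj))
                 (trans a≡b (prodFin-^-decrementAt N j factor b 0<bj)))
        go′ : ∀ k → sumFin N a ≡ k → ∀ i → decrementAt j a i ≡ decrementAt j b i
        go′ zero    Σa≡0 = ⊥-elim (ℕ.1+n≢0 (trans (sym Σa≡1+Σa′) Σa≡0))
        go′ (suc k) Σa≡1+k = go k (decrementAt j a) (decrementAt j b)
          (ℕ.suc-injective (trans (sym Σa≡1+Σa′) Σa≡1+k))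
          (ℕ.<-trans (ℕ.≤-reflexive (sym Σa≡1+Σa′)) Σa<p) (ℕ.<-trans (ℕ.≤-reflexive (sym Σb≡1+Σb′)) Σb<p) a′≡b′

module IntegerPowers (K : Field) where
  open FieldProperties K
  open import Data.Integer using (ℤ; +_; -[1+_])
  import Data.Integer as ℤ
  import Data.Integer.Properties as ℤ
  open ≡-Reasoning

  ^ℤ-*-+ : ∀ x → ¬ (x ≡ 0#) → ∀ r m → 0 ℕ.< m → x ^ℤ (r ℤ.* + m) ≡ (x ^ m) ^ℤ r
  ^ℤ-*-+ x x≢0 (+ k) m _ = begin
    x ^ℤ (+ k ℤ.* + m)         ≡⟨ cong (x ^ℤ_) (ℤ.pos-* k m) ⟨
    x ^ (k ℕ.* m)              ≡⟨ cong (x ^_) (ℕ.*-comm k m) ⟩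
    x ^ (m ℕ.* k)              ≡⟨ ^-* x m k ⟩
    (x ^ m) ^ k                ∎
  ^ℤ-*-+ x x≢0 -[1+ k ] (suc m) _ = begin
    (x ⁻¹) ^ (suc k ℕ.* suc m)     ≡⟨ cong ((x ⁻¹) ^_) (ℕ.*-comm (suc k) (suc m)) ⟩
    (x ⁻¹) ^ (suc m ℕ.* suc k)     ≡⟨ ^-* (x ⁻¹) (suc m) (suc k) ⟩
    ((x ⁻¹) ^ suc m) ^ suc k       ≡⟨ cong (_^ suc k) (⁻¹-^ x (suc m) x≢0) ⟩
    ((x ^ suc m) ⁻¹) ^ suc k       ∎

  ^ℤ-*-^negPart : ∀ w → ¬ (w ≡ 0#) → ∀ r e → w ^ℤ r * w ^ (negPart r ℕ.+ e) ≡ w ^ (posPart r ℕ.+ e)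
  ^ℤ-*-^negPart w w≢0 (+ k)    e = sym (^-+ w k e)
  ^ℤ-*-^negPart w w≢0 -[1+ k ] e = begin
    (w ⁻¹) ^ suc k * w ^ (suc k ℕ.+ e)         ≡⟨ cong ((w ⁻¹) ^ suc k *_) (^-+ w (suc k) e) ⟩
    (w ⁻¹) ^ suc k * (w ^ suc k * w ^ e)       ≡⟨ *-assoc _ _ _ ⟨
    ((w ⁻¹) ^ suc k * w ^ suc k) * w ^ e       ≡⟨ cong (_* w ^ e) (x⁻¹^n*x^n≡1 w (suc k) w≢0) ⟩
    1# * w ^ e                                 ≡⟨ *-identityˡ _ ⟩
    w ^ e                                      ∎

  prodFin-^ℤ-cross : ∀ N (w : Fin N → Carrier) → (∀ i → ¬ (w i ≡ 0#)) → (r s : Fin N → ℤ) →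
    prodFin N (λ i → w i ^ℤ r i) ≡ prodFin N (λ i → w i ^ℤ s i) →
    prodFin N (λ i → w i ^ (posPart (r i) ℕ.+ negPart (s i))) ≡ prodFin N (λ i → w i ^ (posPart (s i) ℕ.+ negPart (r i)))
  prodFin-^ℤ-cross N w w≢0 r s r≡s = begin
    prodFin N (λ i → w i ^ (posPart (r i) ℕ.+ negPart (s i)))             ≡⟨ prodFin-cong N (λ i → ^ℤ-*-^negPart (w i) (w≢0 i) (r i) _) ⟨
    prodFin N (λ i → w i ^ℤ r i * w i ^ (negPart (r i) ℕ.+ negPart (s i))) ≡⟨ prodFin-* N _ _ ⟩
    prodFin N (λ i → w i ^ℤ r i) * D                                     ≡⟨ cong (_* D) r≡s ⟩
    prodFin N (λ i → w i ^ℤ s i) * D                                     ≡⟨ prodFin-* N _ _ ⟨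
    prodFin N (λ i → w i ^ℤ s i * w i ^ (negPart (r i) ℕ.+ negPart (s i))) ≡⟨ prodFin-cong N (λ i →
      trans (cong (λ e → w i ^ℤ s i * w i ^ e) (ℕ.+-comm (negPart (r i)) (negPart (s i))))
            (^ℤ-*-^negPart (w i) (w≢0 i) (s i) (negPart (r i)))) ⟩
    prodFin N (λ i → w i ^ (posPart (s i) ℕ.+ negPart (r i)))             ∎
    where D = prodFin N (λ i → w i ^ (negPart (r i) ℕ.+ negPart (s i)))

module IntegerParts where
  open import Data.Integer using (ℤ; +_; -[1+_])
  open SumFinProperties using (sumFin-+)

  exponent-sum<p : ∀ N {s t p} (x y : Fin N → ℤ) → 0 ℕ.< p → s ℕ.+ t ℕ.≤ p ℕ.∸ 1 →
                   sumFin N (λ i → posPart (x i)) ℕ.≤ s → sumFin N (λ i → negPart (y i)) ℕ.≤ t →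
                   sumFin N (λ i → posPart (x i) ℕ.+ negPart (y i)) ℕ.< p
  exponent-sum<p N {p = p} x y 0<p s+t≤p-1 Σ⁺x≤s Σ⁻y≤t = ℕ.≤-<-trans
    (ℕ.≤-trans (ℕ.≤-reflexive (sumFin-+ N _ _)) (ℕ.≤-trans (ℕ.+-mono-≤ Σ⁺x≤s Σ⁻y≤t) s+t≤p-1))
    (ℕ.∸-monoʳ-< {p} {1} {0} (s≤s z≤n) 0<p)

  posPart+negPart-injective : ∀ r s → posPart r ℕ.+ negPart s ≡ posPart s ℕ.+ negPart r → r ≡ s
  posPart+negPart-injective (+ k)    (+ l)    e = cong +_ (trans (sym (ℕ.+-identityʳ k)) (trans e (ℕ.+-identityʳ l)))
  posPart+negPart-injective (+ k)    -[1+ l ] e with trans (sym (ℕ.+-suc k l)) e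
  ... | ()
  posPart+negPart-injective -[1+ k ] (+ l)    e with trans e (ℕ.+-suc l k)
  ... | ()
  posPart+negPart-injective -[1+ k ] -[1+ l ] e = cong -[1+_] (sym (ℕ.suc-injective e))

module FrobeniusOnθ {p n : ℕ} (p-prime : Prime p) (F : FiniteField (p ℕ.^ n)) (E : ArtinSchreierExt F p) where
  import Data.Integer as ℤ
  private module F = PrimePowerField {n = n} p-prime F
  open ArtinSchreierExt E using (K; ι; ι-+; ι-*; ι-1; θ; θ-root)
  open FieldProperties K
  open ArtinSchreier F E using (module ViaK)
  open ≡-Reasoning

  ι-fromℕ : ∀ m → ι (F.fromℕ m) ≡ fromℕ m
  ι-fromℕ zero    = ViaK.h-0
  ι-fromℕ (suc m) = trans (ι-+ _ _) (cong₂ _+_ ι-1 (ι-fromℕ m))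

  ι-^ : ∀ x k → ι (x F.^ k) ≡ ι x ^ k
  ι-^ x zero    = ι-1
  ι-^ x (suc k) = trans (ι-* _ _) (cong (ι x *_) (ι-^ x k))

  fromℕ-p≡0 : fromℕ p ≡ 0#
  fromℕ-p≡0 = trans (sym (ι-fromℕ p)) (trans (cong ι F.fromℕ-p≡0) ViaK.h-0)

  open Frobenius K p-prime fromℕ-p≡0 public using (frob)
  open Frobenius K p-prime fromℕ-p≡0 using (frob-zero; frob-suc; frob-homo-+; frob-1#)

  frob-θ : ∀ j → frob j θ ≡ θ + fromℕ j
  frob-θ zero    = trans (frob-zero θ) (sym (+-identityʳ θ))
  frob-θ (suc j) = begin
    frob (suc j) θ                 ≡⟨ frob-suc j θ ⟩
    frob j (θ ^ p)                 ≡⟨ cong (frob j) θ-root ⟩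
    frob j (θ + 1#)                ≡⟨ frob-homo-+ j θ 1# ⟩
    frob j θ + frob j 1#           ≡⟨ cong₂ _+_ (frob-θ j) (frob-1# j) ⟩
    (θ + fromℕ j) + 1#             ≡⟨ solve 3 (λ a b c → ((a ⊕ b) ⊕ c) ⊜ (a ⊕ (c ⊕ b))) refl θ (fromℕ j) 1# ⟩
    θ + fromℕ (suc j)              ∎

  frob-θ+ι : ∀ b j → frob j (θ + ι b) ≡ ι (F.shift b j) + θ
  frob-θ+ι b j = begin
    frob j (θ + ι b)                          ≡⟨ frob-homo-+ j θ (ι b) ⟩
    frob j θ + frob j (ι b)                   ≡⟨ cong₂ _+_ (frob-θ j) (sym (ι-^ b (p ℕ.^ j))) ⟩
    (θ + fromℕ j) + ι (F.frob j b)            ≡⟨ solve 3 (λ a b c → ((a ⊕ b) ⊕ c) ⊜ ((b ⊕ c) ⊕ a)) refl θ (fromℕ j) (ι (F.frob j b)) ⟩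
    (fromℕ j + ι (F.frob j b)) + θ            ≡⟨ cong (_+ θ) (trans (ι-+ _ _) (cong (_+ ι (F.frob j b)) (ι-fromℕ j))) ⟨
    ι (F.shift b j) + θ                       ∎

  θ+ι≢0 : 2 ℕ.≤ p → ∀ b → ¬ (θ + ι b ≡ 0#)
  θ+ι≢0 2≤p b θ+b≡0 = ArtinSchreier.ι+θ≢0 F E 2≤p b (trans (+-comm _ _) θ+b≡0)

  ^ℤ-*-p^j : ∀ b r j → (θ + ι b) ^ℤ (r ℤ.* ℤ.+ (p ℕ.^ j)) ≡ (ι (F.shift b j) + θ) ^ℤ r
  ^ℤ-*-p^j b r j = trans (IntegerPowers.^ℤ-*-+ K (θ + ι b) (θ+ι≢0 (PrimeNat.prime⇒2≤ p-prime) b) r (p ℕ.^ j)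
                                                (ℕ.m^n>0 p {{prime⇒nonZero p-prime}} j))
                         (cong (_^ℤ r) (frob-θ+ι b j))

  prodFin-^ℤ-p^j : ∀ b N (r : Fin N → ℤ.ℤ) → prodFin N (λ j → (θ + ι b) ^ℤ (r j ℤ.* ℤ.+ (p ℕ.^ toℕ j)))
                                           ≡ prodFin N (λ j → (ι (F.shift b (toℕ j)) + θ) ^ℤ r j)
  prodFin-^ℤ-p^j b N r = prodFin-cong N (λ j → ^ℤ-*-p^j b (r j) (toℕ j))

open import Data.Nat using (_+_; _*_; _^_; _∸_; _≤_; _<_)
open import Data.Integer using (ℤ; +_)
import Data.Integer

mainTheorem6 :
  (p n : ℕ) → Prime p → ¬ (p ≡ 2) → 0 < n → gcd p n ≡ 1 →
  (F : FiniteField (p ^ n)) →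
  (E : ArtinSchreierExt F p) →
  (b : FiniteField.Carrier F) →
  (∀ m → m ∣ n → m < n → FiniteField.NotInSubfieldOfOrder F (p ^ m) b) →
  (s t : ℕ) → s + t ≤ p ∸ 1 →
  (r r′ : Fin (n * p) → ℤ) →
  InI (n * p) s t r → InI (n * p) s t r′ →
  ArtinSchreierExt.prodFin E (n * p)
    (λ j → ArtinSchreierExt._^ℤ_ E (ArtinSchreierExt._+_ E (ArtinSchreierExt.θ E) (ArtinSchreierExt.ι E b))
                                   (r j Data.Integer.* + (p ^ toℕ j)))
    ≡ ArtinSchreierExt.prodFin E (n * p)
    (λ j → ArtinSchreierExt._^ℤ_ E (ArtinSchreierExt._+_ E (ArtinSchreierExt.θ E) (ArtinSchreierExt.ι E b))
                                   (r′ j Data.Integer.* + (p ^ toℕ j))) →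
  ∀ j → r j ≡ r′ j
mainTheorem6 p n p-prime _ 0<n gcd[p,n]≡1 F E b b∉ s t s+t≤p-1 r r′ (Σ⁻r≤t , Σ⁺r≤s) (Σ⁻r′≤t , Σ⁺r′≤s) Λr≡Λr′ j =
  posPart+negPart-injective (r j) (r′ j)
    (exponents-unique 2≤p c c-injective _ _ (Σ<p r r′ Σ⁺r≤s Σ⁻r′≤t) (Σ<p r′ r Σ⁺r′≤s Σ⁻r≤t)
      (prodFin-^ℤ-cross N (factor 2≤p c c-injective) (λ i → ι+θ≢0 2≤p (c i)) r r′
        (trans (sym (prodFin-^ℤ-p^j b N r)) (trans Λr≡Λr′ (prodFin-^ℤ-p^j b N r′))))
      j)
  where
  open ArtinSchreierExt E using (K)
  open PrimePowerField {n = n} p-prime F using (shift; shift-injectiveFin)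
  open ArtinSchreier F E using (factor; ι+θ≢0; exponents-unique)
  open FrobeniusOnθ {n = n} p-prime F E using (prodFin-^ℤ-p^j)
  open IntegerPowers K using (prodFin-^ℤ-cross)
  open IntegerParts using (posPart+negPart-injective; exponent-sum<p)
  N : ℕ
  N = n * p
  2≤p : 2 ≤ p
  2≤p = PrimeNat.prime⇒2≤ p-prime
  c : Fin N → FiniteField.Carrier F
  c i = shift b (toℕ i)
  c-injective : ∀ i j → c i ≡ c j → i ≡ j
  c-injective = shift-injectiveFin b gcd[p,n]≡1 0<n b∉
  Σ<p : ∀ x y → sumFin N (λ i → posPart (x i)) ≤ s → sumFin N (λ i → negPart (y i)) ≤ t →
        sumFin N (λ i → posPart (x i) + negPart (y i)) < p
  Σ<p x y = exponent-sum<p N x y (ℕ.<-trans (s≤s z≤n) 2≤p) s+t≤p-1
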